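{- Let $n\ge 2$. (i) The first column and the last row of $M_n$ contain only $1$'s; the first row, except its first entry, and the last column, except its last entry, contain only $0$'s. (ii) The first $(n-1)!$ columns of $M_n$ consist of $n$ stacked copies of $M_{n-1}$, i.e. $(M_n)_{k+j(n-1)!,\ell}=(M_{n-1})_{k,\ell}$ for all $1\le k,\ell\le (n-1)!$ and $0\le j<n$. (iii) If $D_R(\tau_k)=D_R(\tau_{k'})$ then the $k$th and $k'$th rows of $M_n$ coincide; if $D_L(\tau_\ell)=D_L(\tau_{\ell'})$ then the $\ell$th and $\ell'$th columns of $M_n$ coincide.
   Context: $B_n^+$ is the monoid generated by $\sigma_1,\dots,\sigma_{n-1}$ subject to $\sigma_i\sigma_j=\sigma_j\sigma_i$ for $|i-j|\ge 2$ and $\sigma_i\sigma_j\sigma_i=\sigma_j\sigma_i\sigma_j$ for $|i-j|=1$, with $B_{m}^+\subseteq B_n^+$ for $m\le n$. Define $\Delta_1=1$, $\Delta_m=\sigma_1\cdots\sigma_{m-1}\Delta_{m-1}$; a positive $m$-braid is simple if it left-divides $\Delta_m$. For simple $x$, $D_L(x)$ (resp. $D_R(x)$) is the set of $i\in\{1,\dots,n-1\}$ with $\sigma_i$ a left (resp. right) divisor of $x$. A pair $(x,y)$ of simple $n$-braids is normal if $x$ is the left gcd of $\Delta_n$ and $xy$; equivalently $D_R(x)\supseteq D_L(y)$. Let $\sigma_{i,m}=\sigma_i\sigma_{i+1}\cdots\sigma_{m-1}$ ($\sigma_{m,m}=1$). Define lists $S_1=(1)$ and $S_m=S_{m-1}\,{}^\frown\,\sigma_{m-1,m}S_{m-1}\,{}^\frown\cdots{}^\frown\,\sigma_{1,m}S_{m-1}$,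 where ${}^\frown$ is concatenation and $zS$ multiplies each entry of $S$ on the left by $z$; $S_{m-1}$ is an initial segment of $S_m$, and $\tau_k$ denotes the $k$th entry (so $S_m=(\tau_1,\dots,\tau_{m!})$ enumerates the simple $m$-braids). $M_m$ is the $m!\times m!$ matrix with $(M_m)_{k,\ell}=1$ if $(\tau_k,\tau_\ell)$ is normal (as a pair of simple $m$-braids) and $0$ otherwise. -}

module Defs where

open import Data.Nat using (ℕ; zero; suc; _+_; _*_; _∸_; _≤_; _<_; _!)

open import Data.List using (List; []; _∷_; _++_; map; concatMap)
open import Data.List.Relation.Unary.All using (All)
open import Data.Product using (Σ; _×_; _,_)
open import Data.Sum using (_⊎_)
open import Function.Bundles using (_⇔_)
open import Relation.Nullary using (¬_)
open import Relation.Binary.PropositionalEquality using (_≡_)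

-- Positive braid words: the generator σ_i is represented by i (i ≥ 1).

Word : Set
Word = List ℕ

infix 4 _≈_
data _≈_ : Word → Word → Set where
  ≈-refl  : ∀ {u} → u ≈ u
  ≈-sym   : ∀ {u v} → u ≈ v → v ≈ u
  ≈-trans : ∀ {u v w} → u ≈ v → v ≈ w → u ≈ w
  ≈-comm  : ∀ u v i j → (suc (suc i) ≤ j ⊎ suc (suc j) ≤ i) →
            u ++ (i ∷ j ∷ v) ≈ u ++ (j ∷ i ∷ v)
  ≈-braid : ∀ u v i j → (j ≡ suc i ⊎ i ≡ suc j) →
            u ++ (i ∷ j ∷ i ∷ v) ≈ u ++ (j ∷ i ∷ j ∷ v)

Gen : ℕ → ℕ → Set
Gen n i = 1 ≤ i × suc i ≤ n

IsWord : ℕ → Word → Set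
IsWord n w = All (Gen n) w

LeftDiv : ℕ → Word → Word → Set
LeftDiv n x y = Σ Word λ z → IsWord n z × (x ++ z ≈ y)

RightDiv : ℕ → Word → Word → Set
RightDiv n x y = Σ Word λ z → IsWord n z × (z ++ x ≈ y)

-- σ_{i,m} = σ_i σ_{i+1} ⋯ σ_{m-1}  (empty if i ≥ m)
σ[_,_] : ℕ → ℕ → Word
σ[ i , m ] = go (m ∸ i) i
  where
    go : ℕ → ℕ → Word
    go zero    _ = []
    go (suc k) j = j ∷ go k (suc j)

Δ : ℕ → Word
Δ zero          = []
Δ (suc zero)    = []
Δ (suc (suc m)) = σ[ 1 , suc (suc m) ] ++ Δ (suc m)

Simple : ℕ → Word → Set
Simple n x = LeftDiv n x (Δ n)

IsLeftGcd : ℕ → Word → Word → Word → Set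
IsLeftGcd n d a b =
  LeftDiv n d a × LeftDiv n d b ×
  (∀ z → IsWord n z → LeftDiv n z a → LeftDiv n z b → LeftDiv n z d)

Normal : ℕ → Word → Word → Set
Normal n x y = IsLeftGcd n x (Δ n) (x ++ y)

DL : ℕ → Word → ℕ → Set
DL n x i = Gen n i × LeftDiv n (i ∷ []) x

DR : ℕ → Word → ℕ → Set
DR n x i = Gen n i × RightDiv n (i ∷ []) x

-- The lists S_m:
--   S_1 = (1),  S_m = S_{m-1} ⁀ σ_{m-1,m} S_{m-1} ⁀ ⋯ ⁀ σ_{1,m} S_{m-1}.

downFrom : ℕ → List ℕ
downFrom zero    = []
downFrom (suc k) = suc k ∷ downFrom k

S : ℕ → List Word
S zero          = [] ∷ []
S (suc zero)    = [] ∷ []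
S (suc (suc m)) =
  concatMap (λ i → map (σ[ i , suc (suc m) ] ++_) (S (suc m)))
            (downFrom (suc (suc m)))

-- 1-indexed lookup (default value [] outside the range, never used below)
nth : List Word → ℕ → Word
nth []      _             = []
nth (x ∷ _) (suc zero)    = x
nth (_ ∷ l) (suc (suc k)) = nth l (suc k)
nth (_ ∷ _) zero          = []

τ : ℕ → ℕ → Word
τ m k = nth (S m) k

-- The matrix M_m: the entry (M_m)_{k,ℓ} is 1 iff (τ_k, τ_ℓ) is normal
-- (as a pair of simple m-braids) and 0 otherwise.  We represent the
-- 0/1 matrix by the proposition "(M_m)_{k,ℓ} = 1".

M : ℕ → ℕ → ℕ → Set
M m k ℓ = Normal m (τ m k) (τ m ℓ)

Idx : ℕ → ℕ → Set
Idx m k = 1 ≤ k × k ≤ m !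

{-# OPTIONS --safe #-}
-- Everything rests on the criterion that a pair (x, y) of simple braids is
-- normal iff D_L(y) ⊆ D_R(x).  Its proof needs a little Garside theory for
-- positive braid words: left cancellativity and the lcm of two generators
-- (Garside's cube argument, by induction on length); squarefreeness of Δ_n,
-- by counting inversions of a permutation action; and, for every entry x of
-- S_n and every generator σ_i, the dichotomy that either σ_i right-divides x
-- or x σ_i is simple.
-- Then (iii) is immediate, and (i) follows from τ_1 = 1, τ_{n!} = Δ_n,
-- D_L(Δ_n) = {1, …, n-1} and the fact that every other τ_k has a simple
-- extension τ_k σ_i.  For (ii), τ_{k+j(n-1)!} = σ_{n-j,n} τ_k has the same
-- right descents as τ_k among the generators of B_{n-1}^+, which contain the
-- left descents of τ_ℓ.
module Submission where

open import Defs
open import Data.Nat using (ℕ; zero; suc; _+_; _*_; _∸_; _≤_; _<_; z≤n; s≤s; _≤?_; _!)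
open import Data.Nat.Properties
open import Algebra.Properties.CommutativeSemigroup +-commutativeSemigroup using (x∙yz≈y∙xz)
open import Data.List using (List; []; _∷_; _++_; length; map; concatMap)
open import Data.List.Properties
  using (++-assoc; ++-identityʳ; length-++; length-map; map-++; map-id; concatMap-++)
open import Data.List.Relation.Unary.All as All using (All; []; _∷_)
open import Data.List.Relation.Unary.AllPairs using (AllPairs; []; _∷_)
open import Data.List.Relation.Unary.All.Properties using (++⁺; ++⁻ˡ; ++⁻ʳ; map⁺; concat⁺)
open import Data.Product using (∃; _×_; _,_; proj₁; proj₂)
open import Data.Sum using (_⊎_; inj₁; inj₂)
open import Data.Unit using (⊤; tt)
open import Data.Empty using (⊥; ⊥-elim)
open import Function.Bundles using (_⇔_; mk⇔; Equivalence)
import Function.Properties.Equivalence as ⇔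
open import Relation.Nullary using (¬_; yes; no)
open import Relation.Binary.PropositionalEquality
open import Relation.Binary.Construct.Closure.ReflexiveTransitive as Star
  using (Star; ε; _◅_; _◅◅_; gmap; return)
open import Relation.Binary.Construct.Closure.ReflexiveTransitive.Properties using (module StarReasoning)

-- Braid words up to the braid relations

Far : ℕ → ℕ → Set
Far i j = suc (suc i) ≤ j ⊎ suc (suc j) ≤ i

Adj : ℕ → ℕ → Set
Adj i j = j ≡ suc i ⊎ i ≡ suc j

far-sym : ∀ {i j} → Far i j → Far j i
far-sym (inj₁ p) = inj₂ p
far-sym (inj₂ p) = inj₁ p

adj-sym : ∀ {i j} → Adj i j → Adj j i
adj-sym (inj₁ e) = inj₂ e
adj-sym (inj₂ e) = inj₁ e

data Step : Word → Word → Set where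
  comm  : ∀ {i j v} → Far i j → Step (i ∷ j ∷ v) (j ∷ i ∷ v)
  braid : ∀ {i j v} → Adj i j → Step (i ∷ j ∷ i ∷ v) (j ∷ i ∷ j ∷ v)
  skip  : ∀ {a u v} → Step u v → Step (a ∷ u) (a ∷ v)

infix 4 _~_
_~_ : Word → Word → Set
_~_ = Star Step

step-sym : ∀ {u v} → Step u v → Step v u
step-sym (comm f)  = comm (far-sym f)
step-sym (braid g) = braid (adj-sym g)
step-sym (skip s)  = skip (step-sym s)

~-sym : ∀ {u v} → u ~ v → v ~ u
~-sym = Star.reverse step-sym

≡⇒~ : ∀ {u v} → u ≡ v → u ~ v
≡⇒~ refl = ε

∷-cong : ∀ a {u v} → u ~ v → a ∷ u ~ a ∷ v
∷-cong a = gmap (a ∷_) skip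

++-congˡ : ∀ w {u v} → u ~ v → w ++ u ~ w ++ v
++-congˡ []      e = e
++-congˡ (a ∷ w) e = ∷-cong a (++-congˡ w e)

step-++ʳ : ∀ w {u v} → Step u v → Step (u ++ w) (v ++ w)
step-++ʳ w (comm f)  = comm f
step-++ʳ w (braid g) = braid g
step-++ʳ w (skip s)  = skip (step-++ʳ w s)

++-congʳ : ∀ w {u v} → u ~ v → u ++ w ~ v ++ w
++-congʳ w = gmap (_++ w) (step-++ʳ w)

step-length : ∀ {u v} → Step u v → length u ≡ length v
step-length (comm f)  = refl
step-length (braid g) = refl
step-length (skip s)  = cong suc (step-length s)

~-length : ∀ {u v} → u ~ v → length u ≡ length v
~-length ε       = refl
~-length (s ◅ p) = trans (step-length s) (~-length p)

step-All : ∀ {P : ℕ → Set} {u v} → Step u v → All P u → All P v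
step-All (comm f)  (pi ∷ pj ∷ r)     = pj ∷ pi ∷ r
step-All (braid g) (pi ∷ pj ∷ _ ∷ r) = pj ∷ pi ∷ pj ∷ r
step-All (skip s)  (pa ∷ r)          = pa ∷ step-All s r

~-All : ∀ {P : ℕ → Set} {u v} → u ~ v → All P u → All P v
~-All ε       a = a
~-All (s ◅ p) a = ~-All p (step-All s a)

≈-∷ : ∀ a {u v} → u ≈ v → a ∷ u ≈ a ∷ v
≈-∷ a ≈-refl                = ≈-refl
≈-∷ a (≈-sym e)             = ≈-sym (≈-∷ a e)
≈-∷ a (≈-trans e f)         = ≈-trans (≈-∷ a e) (≈-∷ a f)
≈-∷ a (≈-comm u v i j f)    = ≈-comm (a ∷ u) v i j f
≈-∷ a (≈-braid u v i j g)   = ≈-braid (a ∷ u) v i j g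

step⇒≈ : ∀ {u v} → Step u v → u ≈ v
step⇒≈ {v = _ ∷ _ ∷ v} (comm {i} {j} f) = ≈-comm [] v i j f
step⇒≈ (braid {i} {j} {v} g)           = ≈-braid [] v i j g
step⇒≈ (skip {a} s)                    = ≈-∷ a (step⇒≈ s)

~⇒≈ : ∀ {u v} → u ~ v → u ≈ v
~⇒≈ ε       = ≈-refl
~⇒≈ (s ◅ p) = ≈-trans (step⇒≈ s) (~⇒≈ p)

≈⇒~ : ∀ {u v} → u ≈ v → u ~ v
≈⇒~ ≈-refl              = ε
≈⇒~ (≈-sym e)           = ~-sym (≈⇒~ e)
≈⇒~ (≈-trans e f)       = ≈⇒~ e ◅◅ ≈⇒~ f
≈⇒~ (≈-comm u v i j f)  = ++-congˡ u (return (comm f))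
≈⇒~ (≈-braid u v i j g) = ++-congˡ u (return (braid g))

-- Least common multiples of two generators and left cancellation

data Relative : ℕ → ℕ → Set where
  equal    : ∀ {a} → Relative a a
  adjacent : ∀ {a b} → Adj a b → Relative a b
  distant  : ∀ {a b} → Far a b → Relative a b

relative-suc : ∀ {a b} → Relative a b → Relative (suc a) (suc b)
relative-suc equal                = equal
relative-suc (adjacent (inj₁ e))  = adjacent (inj₁ (cong suc e))
relative-suc (adjacent (inj₂ e))  = adjacent (inj₂ (cong suc e))
relative-suc (distant (inj₁ p))   = distant (inj₁ (s≤s p))
relative-suc (distant (inj₂ p))   = distant (inj₂ (s≤s p))

relative : ∀ a b → Relative a b
relative zero          zero          = equal
relative zero          (suc zero)    = adjacent (inj₁ refl)
relative zero          (suc (suc b)) = distant (inj₁ (s≤s (s≤s z≤n)))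
relative (suc zero)    zero          = adjacent (inj₂ refl)
relative (suc (suc a)) zero          = distant (inj₂ (s≤s (s≤s z≤n)))
relative (suc a)       (suc b)       = relative-suc (relative a b)

relative-sym : ∀ {a b} → Relative a b → Relative b a
relative-sym equal        = equal
relative-sym (adjacent g) = adjacent (adj-sym g)
relative-sym (distant f)  = distant (far-sym f)

-- σ_a · complement v = σ_b · complement (relative-sym v) is the lcm of σ_a and
-- σ_b for left divisibility.
complement : ∀ {a b} → Relative a b → Word
complement             equal        = []
complement {a} {b} (adjacent _) = b ∷ a ∷ []
complement {a} {b} (distant _)  = b ∷ []

n≢1+n : ∀ n → n ≢ suc n
n≢1+n n = m≢1+n+m n {0}

adj-irrefl : ∀ {a} → ¬ Adj a a
adj-irrefl (inj₁ e) = n≢1+n _ e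
adj-irrefl (inj₂ e) = n≢1+n _ e

far-irrefl : ∀ {a} → ¬ Far a a
far-irrefl (inj₁ p) = <-irrefl refl (<-trans (n<1+n _) p)
far-irrefl (inj₂ p) = <-irrefl refl (<-trans (n<1+n _) p)

adj⇒¬far : ∀ {a b} → Adj a b → ¬ Far a b
adj⇒¬far (inj₁ refl) (inj₁ p) = <-irrefl refl p
adj⇒¬far (inj₁ refl) (inj₂ p) = <-irrefl refl (<-trans (n<1+n _) (<-trans (n<1+n _) p))
adj⇒¬far (inj₂ refl) (inj₁ p) = <-irrefl refl (<-trans (n<1+n _) (<-trans (n<1+n _) p))
adj⇒¬far (inj₂ refl) (inj₂ p) = <-irrefl refl p

¬adj-triangle : ∀ {a k b} → Adj a k → Adj k b → ¬ Adj a b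
¬adj-triangle (inj₁ refl) (inj₁ refl) (inj₁ e) = n≢1+n _ (sym (suc-injective e))
¬adj-triangle (inj₁ refl) (inj₁ refl) (inj₂ e) = m≢1+n+m _ {2} e
¬adj-triangle (inj₁ refl) (inj₂ refl) (inj₁ e) = n≢1+n _ e
¬adj-triangle (inj₁ refl) (inj₂ refl) (inj₂ e) = n≢1+n _ e
¬adj-triangle (inj₂ refl) (inj₁ refl) (inj₁ e) = n≢1+n _ e
¬adj-triangle (inj₂ refl) (inj₁ refl) (inj₂ e) = n≢1+n _ e
¬adj-triangle (inj₂ refl) (inj₂ refl) (inj₁ e) = m≢1+n+m _ {2} e
¬adj-triangle (inj₂ refl) (inj₂ refl) (inj₂ e) = n≢1+n _ (sym (suc-injective e))

complement-unique : ∀ {a b} (v w : Relative a b) → complement v ≡ complement w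
complement-unique equal        equal        = refl
complement-unique equal        (adjacent g) = ⊥-elim (adj-irrefl g)
complement-unique equal        (distant f)  = ⊥-elim (far-irrefl f)
complement-unique (adjacent g) equal        = ⊥-elim (adj-irrefl g)
complement-unique (adjacent g) (adjacent _) = refl
complement-unique (adjacent g) (distant f)  = ⊥-elim (adj⇒¬far g f)
complement-unique (distant f)  equal        = ⊥-elim (far-irrefl f)
complement-unique (distant f)  (adjacent g) = ⊥-elim (adj⇒¬far g f)
complement-unique (distant f)  (distant _)  = refl

ThroughLcm : ∀ {a b} → Relative a b → Word → Word → Set
ThroughLcm v X Y = ∃ λ Z → X ~ complement v ++ Z × Y ~ complement (relative-sym v) ++ Z

LcmBelow : ℕ → Set
LcmBelow n = ∀ {a b X Y} → length X < n → a ∷ X ~ b ∷ Y → (v : Relative a b) → ThroughLcm v X Y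

-- The cube condition, under the hypothesis that the lcm property holds for
-- shorter words.  The cases are named after the relations of (k, a), (k, b)
-- and (a, b), F for far and A for adjacent.
module Cube {n} (ih : LcmBelow n) where

  tail-shorter : ∀ {u x t} → u ~ x ∷ t → length u ≤ n → length t < n
  tail-shorter e le = subst (_≤ n) (~-length e) le

  suc-shorter : ∀ (t : Word) → suc (length t) < n → length t < n
  suc-shorter t = <-trans (n<1+n _)

  ∷-cancel : ∀ {a X Y} → length X < n → a ∷ X ~ a ∷ Y → X ~ Y
  ∷-cancel lt e with ih lt e equal
  ... | Z , h₁ , h₂ = h₁ ◅◅ ~-sym h₂

  ++-cancel : ∀ w {X Y} → length (w ++ X) ≤ n → w ++ X ~ w ++ Y → X ~ Y
  ++-cancel []      le e = e
  ++-cancel (a ∷ w) le e = ++-cancel w (<⇒≤ le) (∷-cancel le e)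

  cube-FFF : ∀ {a k b X Y X₁ Z₁ Z₂} → length X₁ ≤ n → Far k a → Far k b → Far a b →
    X ~ k ∷ Z₁ → X₁ ~ a ∷ Z₁ → X₁ ~ b ∷ Z₂ → Y ~ k ∷ Z₂ →
    ∃ λ Z → X ~ b ∷ Z × Y ~ a ∷ Z
  cube-FFF {a} {k} {b} len fp fq fv hX e₁ e₂ hY
    with ih (tail-shorter e₁ len) (~-sym e₁ ◅◅ e₂) (distant fv)
  ... | W , h₁ , h₂ =
    k ∷ W , hX ◅◅ ∷-cong k h₁ ◅◅ return (comm fq) , hY ◅◅ ∷-cong k h₂ ◅◅ return (comm fp)

  cube-FFA : ∀ {a k b X Y X₁ Z₁ Z₂} → length X₁ ≤ n → Far k a → Far k b → Adj a b →
    X ~ k ∷ Z₁ → X₁ ~ a ∷ Z₁ → X₁ ~ b ∷ Z₂ → Y ~ k ∷ Z₂ →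
    ∃ λ Z → X ~ b ∷ a ∷ Z × Y ~ a ∷ b ∷ Z
  cube-FFA {a} {k} {b} len fp fq gv hX e₁ e₂ hY
    with ih (tail-shorter e₁ len) (~-sym e₁ ◅◅ e₂) (adjacent gv)
  ... | W , h₁ , h₂ =
    k ∷ W , hX ◅◅ ∷-cong k h₁ ◅◅ comm fq ◅ skip (comm fp) ◅ ε ,
            hY ◅◅ ∷-cong k h₂ ◅◅ comm fp ◅ skip (comm fq) ◅ ε

  cube-AFF : ∀ {a k b X Y X₁ Z₁ Z₂} → length X₁ ≤ n → Adj k a → Far k b → Far a b →
    X ~ k ∷ a ∷ Z₁ → X₁ ~ a ∷ k ∷ Z₁ → X₁ ~ b ∷ Z₂ → Y ~ k ∷ Z₂ →
    ∃ λ Z → X ~ b ∷ Z × Y ~ a ∷ Z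
  cube-AFF {a} {k} {b} {Z₁ = Z₁} len gp fq fv hX e₁ e₂ hY
    with ih (tail-shorter e₁ len) (~-sym e₁ ◅◅ e₂) (distant fv)
  ... | W , h₁ , h₂ with ih (suc-shorter Z₁ (tail-shorter e₁ len)) h₁ (distant fq)
  ... | V , g₁ , g₂ = k ∷ a ∷ V ,
        hX ◅◅ ++-congˡ (k ∷ a ∷ []) g₁ ◅◅ skip (comm fv) ◅ comm fq ◅ ε ,
        hY ◅◅ ∷-cong k h₂ ◅◅ ++-congˡ (k ∷ a ∷ []) g₂ ◅◅ braid gp ◅ ε

  cube-AFA : ∀ {a k b X Y X₁ Z₁ Z₂} → length X₁ ≤ n → Adj k a → Far k b → Adj a b →
    X ~ k ∷ a ∷ Z₁ → X₁ ~ a ∷ k ∷ Z₁ → X₁ ~ b ∷ Z₂ → Y ~ k ∷ Z₂ →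
    ∃ λ Z → X ~ b ∷ a ∷ Z × Y ~ a ∷ b ∷ Z
  cube-AFA {a} {k} {b} {Z₁ = Z₁} len gp fq gv hX e₁ e₂ hY
    with ih (tail-shorter e₁ len) (~-sym e₁ ◅◅ e₂) (adjacent gv)
  ... | W , h₁ , h₂ with ih (suc-shorter Z₁ (tail-shorter e₁ len)) h₁ (distant fq)
  ... | V , g₁ , g₂
    with ih (suc-shorter W (tail-shorter h₁ (<⇒≤ (tail-shorter e₁ len)))) g₂ (adjacent (adj-sym gp))
  ... | U , f₁ , f₂ = k ∷ a ∷ b ∷ U ,
        hX ◅◅ ++-congˡ (k ∷ a ∷ []) g₁ ◅◅ ++-congˡ (k ∷ a ∷ b ∷ []) f₂ ◅◅
          skip (braid gv) ◅ comm fq ◅ skip (skip (skip (comm (far-sym fq)))) ◅ skip (braid gp) ◅ ε ,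
        hY ◅◅ ∷-cong k h₂ ◅◅ ++-congˡ (k ∷ a ∷ b ∷ []) f₁ ◅◅
          skip (skip (comm (far-sym fq))) ◅ braid gp ◅ skip (skip (braid gv)) ◅ skip (comm fq) ◅ ε

  cube-AAF : ∀ {a k b X Y X₁ Z₁ Z₂} → length X₁ ≤ n → Adj k a → Adj k b → Far a b →
    X ~ k ∷ a ∷ Z₁ → X₁ ~ a ∷ k ∷ Z₁ → X₁ ~ b ∷ k ∷ Z₂ → Y ~ k ∷ b ∷ Z₂ →
    ∃ λ Z → X ~ b ∷ Z × Y ~ a ∷ Z
  cube-AAF {a} {k} {b} {Z₁ = Z₁} {Z₂ = Z₂} len gp gq fv hX e₁ e₂ hY
    with ih (tail-shorter e₁ len) (~-sym e₁ ◅◅ e₂) (distant fv)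
  ... | W , h₁ , h₂
    with ih (suc-shorter Z₁ (tail-shorter e₁ len)) h₁ (adjacent gq)
       | ih (suc-shorter Z₂ (tail-shorter e₂ len)) h₂ (adjacent gp)
  ... | V , g₁ , g₂ | V' , d₁ , d₂
    with ∷-cancel (tail-shorter g₂ (<⇒≤ (tail-shorter h₁ (<⇒≤ (tail-shorter e₁ len))))) (~-sym g₂ ◅◅ d₂)
  ... | bV~aV'
    with ih (suc-shorter V (tail-shorter g₂ (<⇒≤ (tail-shorter h₁ (<⇒≤ (tail-shorter e₁ len))))))
            bV~aV' (distant (far-sym fv))
  ... | U , c₁ , c₂ = k ∷ b ∷ a ∷ k ∷ U ,
        hX ◅◅ ++-congˡ (k ∷ a ∷ []) g₁ ◅◅ ++-congˡ (k ∷ a ∷ b ∷ k ∷ []) c₁ ◅◅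
          skip (comm fv) ◅ skip (skip (braid (adj-sym gp))) ◅ braid gq ◅ ε ,
        hY ◅◅ ++-congˡ (k ∷ b ∷ []) d₁ ◅◅ ++-congˡ (k ∷ b ∷ a ∷ k ∷ []) c₂ ◅◅
          skip (comm (far-sym fv)) ◅ skip (skip (braid (adj-sym gq))) ◅ braid gp ◅
          skip (skip (comm fv)) ◅ ε

  cube : ∀ {a k b X Y X₁ Z₁ Z₂} → length X₁ ≤ n →
    (p : Relative k a) → X ~ complement (relative-sym p) ++ Z₁ → X₁ ~ complement p ++ Z₁ →
    (q : Relative k b) → X₁ ~ complement q ++ Z₂ → Y ~ complement (relative-sym q) ++ Z₂ →
    (v : Relative a b) → ThroughLcm v X Y
  cube {Z₂ = Z₂} len equal hX e₁ q e₂ hY v =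
    Z₂ , hX ◅◅ ~-sym e₁ ◅◅ e₂ ◅◅ ≡⇒~ (cong (_++ Z₂) (complement-unique q v)) ,
         hY ◅◅ ≡⇒~ (cong (_++ Z₂) (complement-unique (relative-sym q) (relative-sym v)))
  cube {Z₁ = Z₁} len p@(adjacent _) hX e₁ equal e₂ hY v =
    Z₁ , hX ◅◅ ≡⇒~ (cong (_++ Z₁) (complement-unique (relative-sym p) v)) ,
         hY ◅◅ ~-sym e₂ ◅◅ e₁ ◅◅ ≡⇒~ (cong (_++ Z₁) (complement-unique p (relative-sym v)))
  cube {Z₁ = Z₁} len p@(distant _) hX e₁ equal e₂ hY v =
    Z₁ , hX ◅◅ ≡⇒~ (cong (_++ Z₁) (complement-unique (relative-sym p) v)) ,
         hY ◅◅ ~-sym e₂ ◅◅ e₁ ◅◅ ≡⇒~ (cong (_++ Z₁) (complement-unique p (relative-sym v)))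
  cube {X = X} {Z₁ = Z₁} {Z₂ = Z₂} len p hX e₁ q e₂ hY equal =
    X , ε , hY ◅◅ ≡⇒~ (cong (_++ Z₂) (complement-unique (relative-sym q) (relative-sym p)))
               ◅◅ ++-congˡ (complement (relative-sym p)) (~-sym Z₁~Z₂) ◅◅ ~-sym hX
    where
    Z₁~Z₂ : Z₁ ~ Z₂
    Z₁~Z₂ = ++-cancel (complement p) (subst (_≤ n) (~-length e₁) len)
              (~-sym e₁ ◅◅ e₂ ◅◅ ≡⇒~ (cong (_++ Z₂) (complement-unique q p)))
  cube len (distant fp)  hX e₁ (distant fq)  e₂ hY (distant fv)  = cube-FFF len fp fq fv hX e₁ e₂ hY
  cube len (distant fp)  hX e₁ (distant fq)  e₂ hY (adjacent gv) = cube-FFA len fp fq gv hX e₁ e₂ hY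
  cube len (adjacent gp) hX e₁ (distant fq)  e₂ hY (distant fv)  = cube-AFF len gp fq fv hX e₁ e₂ hY
  cube len (adjacent gp) hX e₁ (distant fq)  e₂ hY (adjacent gv) = cube-AFA len gp fq gv hX e₁ e₂ hY
  cube len (adjacent gp) hX e₁ (adjacent gq) e₂ hY (distant fv)  = cube-AAF len gp gq fv hX e₁ e₂ hY
  cube len (adjacent gp) hX e₁ (adjacent gq) e₂ hY (adjacent gv) =
    ⊥-elim (¬adj-triangle (adj-sym gp) gq gv)
  cube len (distant fp)  hX e₁ (adjacent gq) e₂ hY (distant fv)
    with cube-AFF len gq fp (far-sym fv) hY e₂ e₁ hX
  ... | Z , y , x = Z , x , y
  cube len (distant fp)  hX e₁ (adjacent gq) e₂ hY (adjacent gv)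
    with cube-AFA len gq fp (adj-sym gv) hY e₂ e₁ hX
  ... | Z , y , x = Z , x , y

-- Inner induction on the rewriting sequence: its first step a X ~ k X₁ at the
-- head is combined with the result for k X₁ ~ b Y by the cube condition.
lcm-step : ∀ n → LcmBelow n → ∀ {a b X Y} → length X ≤ n → a ∷ X ~ b ∷ Y →
           (v : Relative a b) → ThroughLcm v X Y
lcm-step n ih {X = X} le ε equal        = X , ε , ε
lcm-step n ih         le ε (adjacent g) = ⊥-elim (adj-irrefl g)
lcm-step n ih         le ε (distant f)  = ⊥-elim (far-irrefl f)
lcm-step n ih le (skip s ◅ rest) v with lcm-step n ih (subst (_≤ n) (step-length s) le) rest v
... | Z , h₁ , h₂ = Z , s ◅ h₁ , h₂
lcm-step n ih {b = b} le (comm {a} {k} f ◅ rest) v with lcm-step n ih le rest (relative k b)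
... | Z₂ , h₁ , h₂ = Cube.cube ih le (distant (far-sym f)) ε ε (relative k b) h₁ h₂ v
lcm-step n ih {b = b} le (braid {a} {k} g ◅ rest) v with lcm-step n ih le rest (relative k b)
... | Z₂ , h₁ , h₂ = Cube.cube ih le (adjacent (adj-sym g)) ε ε (relative k b) h₁ h₂ v

lcm-below : ∀ n → LcmBelow n
lcm-below zero    ()
lcm-below (suc n) lt = lcm-step n (lcm-below n) (≤-pred lt)

lcm-factor : ∀ {a b X Y} → a ∷ X ~ b ∷ Y → (v : Relative a b) → ThroughLcm v X Y
lcm-factor {X = X} = lcm-below (suc (length X)) ≤-refl

∷-cancelˡ : ∀ {a X Y} → a ∷ X ~ a ∷ Y → X ~ Y
∷-cancelˡ e with lcm-factor e equal
... | Z , h₁ , h₂ = h₁ ◅◅ ~-sym h₂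

infix 4 _≼_
_≼_ : Word → Word → Set
x ≼ y = ∃ λ z → x ++ z ~ y

NoCommonHead : Word → Word → Set
NoCommonHead p y = ∀ i {w w'} → i ∷ w ~ p → i ∷ w' ~ y → ⊥

-- n bounds the length of x: in the adjacent case the recursion is on a word
-- that is only shorter, not a subterm.
head-divides-prefix : ∀ n x {p y a w₁ w₂} → length x ≤ n → NoCommonHead p y →
  a ∷ w₁ ~ x ++ p → a ∷ w₂ ~ x ++ y → ∃ λ x' → a ∷ x' ~ x
head-divides-prefix n [] le cp e₁ e₂ = ⊥-elim (cp _ e₁ e₂)
head-divides-prefix n (b ∷ x) {a = a} le cp e₁ e₂ with relative a b
... | equal = x , ε
head-divides-prefix (suc n) (b ∷ x) le cp e₁ e₂ | distant f
  with lcm-factor e₁ (distant f) | lcm-factor e₂ (distant f)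
... | _ , _ , h | _ , _ , h' with head-divides-prefix n x (≤-pred le) cp (~-sym h) (~-sym h')
... | x' , k = b ∷ x' , comm f ◅ ∷-cong b k
head-divides-prefix (suc n) (b ∷ x) {p} {y} {a} le cp e₁ e₂ | adjacent g
  with lcm-factor e₁ (adjacent g) | lcm-factor e₂ (adjacent g)
... | _ , _ , h | _ , _ , h' with head-divides-prefix n x (≤-pred le) cp (~-sym h) (~-sym h')
... | x' , k
  with head-divides-prefix n x' (<⇒≤ (subst (_≤ n) (sym (~-length k)) (≤-pred le))) cp
         (∷-cancelˡ (~-sym h ◅◅ ++-congʳ p (~-sym k))) (∷-cancelˡ (~-sym h' ◅◅ ++-congʳ y (~-sym k)))
... | x'' , k' = b ∷ a ∷ x'' , braid g ◅ ∷-cong b (∷-cong a k' ◅◅ k)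

≼-prefix : ∀ z x {p y} → NoCommonHead p y → z ≼ x ++ p → z ≼ x ++ y → z ≼ x
≼-prefix []      x cp d₁ d₂ = x , ε
≼-prefix (a ∷ z) x {p} {y} cp (w₁ , e₁) (w₂ , e₂)
  with head-divides-prefix (length x) x ≤-refl cp e₁ e₂
... | x' , k with ≼-prefix z x' cp (w₁ , ∷-cancelˡ (e₁ ◅◅ ++-congʳ p (~-sym k)))
                                   (w₂ , ∷-cancelˡ (e₂ ◅◅ ++-congʳ y (~-sym k)))
... | w , e = w , ∷-cong a e ◅◅ k

-- Runs of consecutive generators and the words Δ_n

run : ℕ → ℕ → Word
run zero    _ = []
run (suc k) j = j ∷ run k (suc j)

-- σ[_,_] recurses through a local function that cannot be named here, so its
-- equations are reached by abstracting over the difference m ∸ i.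
σ-run-+ : ∀ k j → σ[ j , k + j ] ≡ run k j
σ-run-+ k j with (k + j) ∸ j | m+n∸n≡m k j
σ-run-+ zero    j | _ | refl = refl
σ-run-+ (suc k) j | _ | refl with (k + suc j) ∸ suc j | m+n∸n≡m k (suc j) | σ-run-+ k (suc j)
... | _ | refl | e = cong (j ∷_) e

σ-cong-∸ : ∀ i m m' → m ∸ i ≡ m' ∸ i → σ[ i , m ] ≡ σ[ i , m' ]
σ-cong-∸ i m m' e with m ∸ i | m' ∸ i | e
... | _ | _ | refl = refl

σ-run : ∀ i m → σ[ i , m ] ≡ run (m ∸ i) i
σ-run i m = trans (σ-cong-∸ i m (m ∸ i + i) (sym (m+n∸n≡m (m ∸ i) i))) (σ-run-+ (m ∸ i) i)

Δ-unfold : ∀ k → Δ (suc (suc k)) ≡ run (suc k) 1 ++ Δ (suc k)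
Δ-unfold k = cong (_++ Δ (suc k)) (σ-run 1 (suc (suc k)))

length-run : ∀ k j → length (run k j) ≡ k
length-run zero    j = refl
length-run (suc k) j = cong suc (length-run k (suc j))

run-++ : ∀ p q b → run (p + q) b ≡ run p b ++ run q (b + p)
run-++ zero    q b = cong (run q) (sym (+-identityʳ b))
run-++ (suc p) q b =
  cong (b ∷_) (trans (run-++ p q (suc b)) (cong (λ t → run p (suc b) ++ run q t) (sym (+-suc b p))))

run-bounds : ∀ d b → All (λ x → b ≤ x × x < b + d) (run d b)
run-bounds zero    b = []
run-bounds (suc d) b = (≤-refl , subst (b <_) (sym (+-suc b d)) (s≤s (m≤m+n b d)))
  ∷ All.map (λ {x} (p , q) → <⇒≤ p , subst (x <_) (sym (+-suc b d)) q) (run-bounds d (suc b))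

run-Gen : ∀ k j n → 1 ≤ j → j + k ≤ n → IsWord n (run k j)
run-Gen zero    j n _ _ = []
run-Gen (suc k) j n p q =
  (p , ≤-trans (s≤s (m≤m+n j k)) (subst (_≤ n) (+-suc j k) q))
  ∷ run-Gen k (suc j) n (≤-trans p (n≤1+n j)) (subst (_≤ n) (+-suc j k) q)

Gen-suc : ∀ {n i} → Gen n i → Gen (suc n) i
Gen-suc (p , q) = p , m≤n⇒m≤1+n q

Δ-IsWord : ∀ n → IsWord n (Δ n)
Δ-IsWord zero          = []
Δ-IsWord (suc zero)    = []
Δ-IsWord (suc (suc k)) = subst (IsWord (suc (suc k))) (sym (Δ-unfold k))
  (++⁺ (run-Gen (suc k) 1 (suc (suc k)) ≤-refl ≤-refl) (All.map Gen-suc (Δ-IsWord (suc k))))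

-- Δ is squarefree

-- σ_i acts on a list by exchanging its entries at (0-based) positions i and i+1.
swapAt : ℕ → List ℕ → List ℕ
swapAt zero    (x ∷ y ∷ r) = y ∷ x ∷ r
swapAt zero    l           = l
swapAt (suc i) []          = []
swapAt (suc i) (x ∷ r)     = x ∷ swapAt i r

permute : Word → List ℕ → List ℕ
permute []      L = L
permute (i ∷ w) L = permute w (swapAt i L)

permute-++ : ∀ u w L → permute (u ++ w) L ≡ permute w (permute u L)
permute-++ []      w L = refl
permute-++ (i ∷ u) w L = permute-++ u w (swapAt i L)

length-swapAt : ∀ i L → length (swapAt i L) ≡ length L
length-swapAt zero    []          = refl
length-swapAt zero    (x ∷ [])    = refl
length-swapAt zero    (x ∷ y ∷ L) = refl
length-swapAt (suc i) []          = refl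
length-swapAt (suc i) (x ∷ L)     = cong suc (length-swapAt i L)

swapAt-involutive : ∀ i L → swapAt i (swapAt i L) ≡ L
swapAt-involutive zero    []          = refl
swapAt-involutive zero    (x ∷ [])    = refl
swapAt-involutive zero    (x ∷ y ∷ L) = refl
swapAt-involutive (suc i) []          = refl
swapAt-involutive (suc i) (x ∷ L)     = cong (x ∷_) (swapAt-involutive i L)

swapAt-comm : ∀ i j → suc (suc i) ≤ j → ∀ L → swapAt i (swapAt j L) ≡ swapAt j (swapAt i L)
swapAt-comm zero    (suc (suc j)) (s≤s (s≤s _)) []          = refl
swapAt-comm zero    (suc (suc j)) (s≤s (s≤s _)) (x ∷ [])    = refl
swapAt-comm zero    (suc (suc j)) (s≤s (s≤s _)) (x ∷ y ∷ L) = refl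
swapAt-comm (suc i) (suc j)       _             []          = refl
swapAt-comm (suc i) (suc j)       (s≤s p)       (x ∷ L)     = cong (x ∷_) (swapAt-comm i j p L)

swapAt-braid : ∀ i L → suc (suc (suc i)) ≤ length L →
  swapAt i (swapAt (suc i) (swapAt i L)) ≡ swapAt (suc i) (swapAt i (swapAt (suc i) L))
swapAt-braid zero    (x ∷ y ∷ z ∷ L) _        = refl
swapAt-braid zero    (x ∷ [])        (s≤s ())
swapAt-braid zero    (x ∷ y ∷ [])    (s≤s (s≤s ()))
swapAt-braid (suc i) (x ∷ L)         (s≤s le) = cong (x ∷_) (swapAt-braid i L le)

Acts : ℕ → ℕ → Set
Acts N i = suc (suc i) ≤ N

permute-step : ∀ {u v} L → Step u v → All (Acts (length L)) u → permute u L ≡ permute v L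
permute-step {v = _ ∷ _ ∷ v} L (comm {i} {j} (inj₁ p)) _ = cong (permute v) (sym (swapAt-comm i j p L))
permute-step {v = _ ∷ _ ∷ v} L (comm {i} {j} (inj₂ p)) _ = cong (permute v) (swapAt-comm j i p L)
permute-step L (braid {i} {v = v} (inj₁ refl)) (_ ∷ b ∷ _) = cong (permute v) (swapAt-braid i L b)
permute-step L (braid {j = j} {v} (inj₂ refl)) (b ∷ _)     = cong (permute v) (sym (swapAt-braid j L b))
permute-step L (skip {a} s) (_ ∷ r) =
  permute-step (swapAt a L) s (subst (λ N → All (Acts N) _) (sym (length-swapAt a L)) r)

permute-~ : ∀ {u v} L → u ~ v → All (Acts (length L)) u → permute u L ≡ permute v L
permute-~ L ε       _ = refl
permute-~ L (s ◅ p) b = trans (permute-step L s b) (permute-~ L p (step-All s b))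

below : ℕ → ℕ → ℕ
below zero    (suc _) = 1
below _       zero    = 0
below (suc y) (suc x) = below y x

below≤1 : ∀ y x → below y x ≤ 1
below≤1 zero    zero    = z≤n
below≤1 zero    (suc x) = ≤-refl
below≤1 (suc y) zero    = z≤n
below≤1 (suc y) (suc x) = below≤1 y x

below-< : ∀ {y x} → y < x → below y x ≡ 1
below-< {zero}  {suc x} _       = refl
below-< {suc y} {suc x} (s≤s p) = below-< p

below-≥ : ∀ {y x} → x ≤ y → below y x ≡ 0
below-≥ {zero}  {zero}  _       = refl
below-≥ {suc y} {zero}  _       = refl
below-≥ {suc y} {suc x} (s≤s p) = below-≥ p

countBelow : ℕ → List ℕ → ℕ
countBelow x []      = 0
countBelow x (y ∷ r) = below y x + countBelow x r

inversions : List ℕ → ℕ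
inversions []      = 0
inversions (x ∷ r) = countBelow x r + inversions r


countBelow-swapAt : ∀ z i r → countBelow z (swapAt i r) ≡ countBelow z r
countBelow-swapAt z zero    []          = refl
countBelow-swapAt z zero    (x ∷ [])    = refl
countBelow-swapAt z zero    (x ∷ y ∷ r) = x∙yz≈y∙xz (below y z) (below x z) (countBelow z r)
countBelow-swapAt z (suc i) []          = refl
countBelow-swapAt z (suc i) (x ∷ r)     = cong (below x z +_) (countBelow-swapAt z i r)

inversions-swapAt-≤ : ∀ i L → inversions (swapAt i L) ≤ suc (inversions L)
inversions-swapAt-≤ zero    []          = n≤1+n _
inversions-swapAt-≤ zero    (x ∷ [])    = n≤1+n _
inversions-swapAt-≤ zero    (x ∷ y ∷ r) = begin
  countBelow y (x ∷ r) + (countBelow x r + inversions r)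
    ≤⟨ +-monoˡ-≤ _ (+-monoˡ-≤ (countBelow y r) (below≤1 x y)) ⟩
  suc (countBelow y r + (countBelow x r + inversions r))
    ≡⟨ cong suc (x∙yz≈y∙xz (countBelow y r) (countBelow x r) (inversions r)) ⟩
  suc (countBelow x r + (countBelow y r + inversions r))
    ≤⟨ s≤s (+-monoˡ-≤ _ (m≤n+m (countBelow x r) (below y x))) ⟩
  suc (countBelow x (y ∷ r) + (countBelow y r + inversions r)) ∎
  where open ≤-Reasoning
inversions-swapAt-≤ (suc i) []      = n≤1+n _
inversions-swapAt-≤ (suc i) (x ∷ r) = begin
  countBelow x (swapAt i r) + inversions (swapAt i r)
    ≡⟨ cong (_+ inversions (swapAt i r)) (countBelow-swapAt x i r) ⟩
  countBelow x r + inversions (swapAt i r)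
    ≤⟨ +-monoʳ-≤ (countBelow x r) (inversions-swapAt-≤ i r) ⟩
  countBelow x r + suc (inversions r)
    ≡⟨ +-suc _ _ ⟩
  suc (countBelow x r + inversions r) ∎
  where open ≤-Reasoning

AscentAt : ℕ → List ℕ → Set
AscentAt zero    (x ∷ y ∷ _) = x < y
AscentAt zero    _           = ⊥
AscentAt (suc i) []          = ⊥
AscentAt (suc i) (_ ∷ r)     = AscentAt i r

inversions-swapAt-ascent : ∀ i L → AscentAt i L → inversions (swapAt i L) ≡ suc (inversions L)
inversions-swapAt-ascent zero (x ∷ y ∷ r) x<y = begin
  countBelow y (x ∷ r) + (countBelow x r + inversions r)
    ≡⟨ cong (λ c → c + countBelow y r + (countBelow x r + inversions r)) (below-< x<y) ⟩
  suc (countBelow y r + (countBelow x r + inversions r))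
    ≡⟨ cong suc (x∙yz≈y∙xz (countBelow y r) (countBelow x r) (inversions r)) ⟩
  suc (countBelow x r + (countBelow y r + inversions r))
    ≡⟨ cong (λ c → suc (c + countBelow x r + (countBelow y r + inversions r))) (below-≥ (<⇒≤ x<y)) ⟨
  suc (countBelow x (y ∷ r) + (countBelow y r + inversions r)) ∎
  where open ≡-Reasoning
inversions-swapAt-ascent (suc i) (x ∷ r) a = begin
  countBelow x (swapAt i r) + inversions (swapAt i r)
    ≡⟨ cong₂ _+_ (countBelow-swapAt x i r) (inversions-swapAt-ascent i r a) ⟩
  countBelow x r + suc (inversions r)
    ≡⟨ +-suc _ _ ⟩
  suc (countBelow x r + inversions r) ∎
  where open ≡-Reasoning

inversions-permute-≤ : ∀ w L → inversions (permute w L) ≤ length w + inversions L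
inversions-permute-≤ []      L = ≤-refl
inversions-permute-≤ (i ∷ w) L = begin
  inversions (permute w (swapAt i L))  ≤⟨ inversions-permute-≤ w (swapAt i L) ⟩
  length w + inversions (swapAt i L)   ≤⟨ +-monoʳ-≤ (length w) (inversions-swapAt-≤ i L) ⟩
  length w + suc (inversions L)        ≡⟨ +-suc _ _ ⟩
  suc (length w + inversions L)        ∎
  where open ≤-Reasoning

AscentsOnly : Word → List ℕ → Set
AscentsOnly []      L = ⊤
AscentsOnly (i ∷ w) L = AscentAt i L × AscentsOnly w (swapAt i L)

AscentsOnly-++ : ∀ u w L → AscentsOnly u L → AscentsOnly w (permute u L) → AscentsOnly (u ++ w) L
AscentsOnly-++ []      w L _        r₂ = r₂
AscentsOnly-++ (i ∷ u) w L (a , r₁) r₂ = a , AscentsOnly-++ u w (swapAt i L) r₁ r₂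

inversions-permute-ascents : ∀ w L → AscentsOnly w L → inversions (permute w L) ≡ length w + inversions L
inversions-permute-ascents []      L _       = refl
inversions-permute-ascents (i ∷ w) L (a , r) = begin
  inversions (permute w (swapAt i L))  ≡⟨ inversions-permute-ascents w (swapAt i L) r ⟩
  length w + inversions (swapAt i L)   ≡⟨ cong (length w +_) (inversions-swapAt-ascent i L a) ⟩
  length w + suc (inversions L)        ≡⟨ +-suc _ _ ⟩
  suc (length w + inversions L)        ∎
  where open ≡-Reasoning

run-above : ∀ k {j c} → c < j → All (c <_) (run k j)
run-above zero    _   = []
run-above (suc k) c<j = c<j ∷ run-above k (<-trans c<j (n<1+n _))

run-increasing : ∀ k j → AllPairs _<_ (run k j)
run-increasing zero    j = []
run-increasing (suc k) j = run-above k (n<1+n j) ∷ run-increasing k (suc j)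

swapAt-length : ∀ P a b r → swapAt (length P) (P ++ a ∷ b ∷ r) ≡ P ++ b ∷ a ∷ r
swapAt-length []      a b r = refl
swapAt-length (x ∷ P) a b r = cong (x ∷_) (swapAt-length P a b r)

ascentAt-length : ∀ P {a b} r → a < b → AscentAt (length P) (P ++ a ∷ b ∷ r)
ascentAt-length []      r a<b = a<b
ascentAt-length (x ∷ P) r a<b = ascentAt-length P r a<b

length-∷ʳ : ∀ (P : List ℕ) y → length (P ++ y ∷ []) ≡ suc (length P)
length-∷ʳ P y = trans (length-++ P) (+-comm (length P) 1)

run-bubbles : ∀ P M x rest → All (x <_) M →
  AscentsOnly (run (length M) (length P)) (P ++ x ∷ M ++ rest) ×
  permute (run (length M) (length P)) (P ++ x ∷ M ++ rest) ≡ P ++ M ++ x ∷ rest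
run-bubbles P []      x rest _        = tt , refl
run-bubbles P (y ∷ M) x rest (p ∷ ps) with run-bubbles (P ++ y ∷ []) M x rest ps
... | asc , eq =
  (ascentAt-length P (M ++ rest) p ,
   subst (AscentsOnly (run (length M) (suc (length P)))) (sym (swapAt-length P x y (M ++ rest)))
     (subst₂ AscentsOnly (cong (run (length M)) (length-∷ʳ P y)) (++-assoc P (y ∷ []) _) asc)) ,
  trans (cong (permute (run (length M) (suc (length P)))) (swapAt-length P x y (M ++ rest)))
    (trans (cong₂ (λ j L → permute (run (length M) j) L)
                  (sym (length-∷ʳ P y)) (sym (++-assoc P (y ∷ []) _)))
      (trans eq (++-assoc P (y ∷ []) _)))

Δ-ascents : ∀ m d M rest → AllPairs _<_ M → length M ≡ m → AscentsOnly (Δ m) (d ∷ M ++ rest)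
Δ-ascents zero          d M        rest _        _   = tt
Δ-ascents (suc zero)    d M        rest _        _   = tt
Δ-ascents (suc (suc k)) d (x ∷ M) rest (px ∷ sM) len =
  subst (λ w → AscentsOnly w (d ∷ x ∷ M ++ rest)) (sym (Δ-unfold k))
    (AscentsOnly-++ (run (suc k) 1) (Δ (suc k)) (d ∷ x ∷ M ++ rest)
      (subst (λ j → AscentsOnly (run j 1) (d ∷ x ∷ M ++ rest)) len' (proj₁ bubble))
      (subst (AscentsOnly (Δ (suc k)))
        (sym (trans (cong (λ j → permute (run j 1) (d ∷ x ∷ M ++ rest)) (sym len')) (proj₂ bubble)))
        (Δ-ascents (suc k) d M (x ∷ rest) sM len')))
  where
  len' = suc-injective len
  bubble = run-bubbles (d ∷ []) M x rest px

-- Δ_n acts on (0, 1, …, n) through ascents only, so it raises the number of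
-- inversions by its length, which a word containing σ_i σ_i cannot do.
Δ-squarefree : ∀ n u i v → ¬ (u ++ i ∷ i ∷ v ~ Δ n)
Δ-squarefree n u i v e =
  <-irrefl refl (≤-trans (n≤1+n _) (+-cancelʳ-≤ (inversions L₀) (suc (suc ℓ)) ℓ inversions-bound))
  where
  L₀ = 0 ∷ run n 1
  ℓ = length u + length v
  ascents : AscentsOnly (Δ n) L₀
  ascents = subst (λ M → AscentsOnly (Δ n) (0 ∷ M)) (++-identityʳ _)
              (Δ-ascents n 0 (run n 1) [] (run-increasing n 1) (length-run n 1))
  acts : All (Acts (length L₀)) (Δ n)
  acts = All.map (λ (_ , q) → s≤s (subst (_ ≤_) (sym (length-run n 1)) q)) (Δ-IsWord n)
  square-cancels : permute (Δ n) L₀ ≡ permute (u ++ v) L₀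
  square-cancels = begin
    permute (Δ n) L₀                    ≡⟨ permute-~ L₀ (~-sym e) acts ⟩
    permute (u ++ i ∷ i ∷ v) L₀         ≡⟨ permute-++ u (i ∷ i ∷ v) L₀ ⟩
    permute v (swapAt i (swapAt i (permute u L₀)))
                                        ≡⟨ cong (permute v) (swapAt-involutive i (permute u L₀)) ⟩
    permute v (permute u L₀)            ≡⟨ permute-++ u v L₀ ⟨
    permute (u ++ v) L₀                 ∎
    where open ≡-Reasoning
  length-Δ : length (Δ n) ≡ suc (suc ℓ)
  length-Δ = trans (sym (~-length e)) (trans (length-++ u) (trans (+-suc _ _) (cong suc (+-suc _ _))))
  inversions-bound : suc (suc ℓ) + inversions L₀ ≤ ℓ + inversions L₀
  inversions-bound = begin
    suc (suc ℓ) + inversions L₀          ≡⟨ cong (_+ inversions L₀) length-Δ ⟨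
    length (Δ n) + inversions L₀         ≡⟨ inversions-permute-ascents (Δ n) L₀ ascents ⟨
    inversions (permute (Δ n) L₀)        ≡⟨ cong inversions square-cancels ⟩
    inversions (permute (u ++ v) L₀)     ≤⟨ inversions-permute-≤ (u ++ v) L₀ ⟩
    length (u ++ v) + inversions L₀      ≡⟨ cong (_+ inversions L₀) (length-++ u) ⟩
    ℓ + inversions L₀                    ∎
    where open ≤-Reasoning

commute-past : ∀ i w r → All (Far i) w → w ++ i ∷ r ~ i ∷ w ++ r
commute-past i []      r _        = ε
commute-past i (x ∷ w) r (f ∷ fs) = ∷-cong x (commute-past i w r fs) ◅◅ return (comm (far-sym f))

commute-past-word : ∀ u w r → All (λ i → All (Far i) w) u → w ++ u ++ r ~ u ++ w ++ r
commute-past-word []      w r _        = ε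
commute-past-word (i ∷ u) w r (f ∷ fs) = commute-past i w (u ++ r) f ◅◅ ∷-cong i (commute-past-word u w r fs)

run-exchange-adjacent : ∀ c j → run j (suc c) ++ run (suc j) c ~ run (suc j) c ++ run j c
run-exchange-adjacent c zero    = ε
run-exchange-adjacent c (suc j) = begin
  suc c ∷ R ++ c ∷ suc c ∷ R
    ⟶*⟨ ∷-cong (suc c) (commute-past c R (suc c ∷ R) far) ⟩
  suc c ∷ c ∷ R ++ suc c ∷ R
    ⟶*⟨ ∷-cong (suc c) (∷-cong c (run-exchange-adjacent (suc c) j)) ⟩
  suc c ∷ c ∷ suc c ∷ R ++ run j (suc c)
    ⟶⟨ braid (inj₂ refl) ⟩
  c ∷ suc c ∷ c ∷ R ++ run j (suc c)
    ⟶*⟨ ∷-cong c (∷-cong (suc c) (~-sym (commute-past c R (run j (suc c)) far))) ⟩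
  c ∷ suc c ∷ R ++ c ∷ run j (suc c) ∎
  where
  open StarReasoning Step
  R = run j (suc (suc c))
  far : All (Far c) R
  far = All.map (λ (p , _) → inj₁ p) (run-bounds j (suc (suc c)))

run-exchange : ∀ b d j → run j (suc (b + d)) ++ run (d + suc j) b ~ run (d + suc j) b ++ run j (b + d)
run-exchange b d j = begin
  run j (suc (b + d)) ++ run (d + suc j) b
    ≡⟨ cong (run j (suc (b + d)) ++_) (run-++ d (suc j) b) ⟩
  run j (suc (b + d)) ++ run d b ++ run (suc j) (b + d)
    ⟶*⟨ commute-past-word (run d b) (run j (suc (b + d))) (run (suc j) (b + d)) far ⟩
  run d b ++ run j (suc (b + d)) ++ run (suc j) (b + d)
    ⟶*⟨ ++-congˡ (run d b) (run-exchange-adjacent (b + d) j) ⟩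
  run d b ++ run (suc j) (b + d) ++ run j (b + d)
    ≡⟨ trans (sym (++-assoc (run d b) _ _)) (cong (_++ run j (b + d)) (sym (run-++ d (suc j) b))) ⟩
  run (d + suc j) b ++ run j (b + d)  ∎
  where
  open StarReasoning Step
  far : All (λ i → All (Far i) (run j (suc (b + d)))) (run d b)
  far = All.map (λ (_ , q) → All.map (λ (p' , _) → inj₁ (≤-trans (s≤s q) p')) (run-bounds j (suc (b + d))))
                (run-bounds d b)

-- The entries of S_n

-- run j a is σ_{a,a+j}, so these are the words σ_{a_n,n} σ_{a_{n-1},n-1} ⋯ σ_{a_2,2}.
data Canonical : ℕ → Word → Set where
  base : Canonical 1 []
  cons : ∀ {n a j x} → 1 ≤ a → a + j ≡ suc (suc n) → Canonical (suc n) x →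
         Canonical (suc (suc n)) (run j a ++ x)

Canonical-IsWord : ∀ {n x} → Canonical n x → IsWord n x
Canonical-IsWord base = []
Canonical-IsWord (cons {n} {a} {j} p e cx) =
  ++⁺ (run-Gen j a (suc (suc n)) p (≤-reflexive e)) (All.map Gen-suc (Canonical-IsWord cx))

IsWord⇒far : ∀ {k x} → IsWord k x → All (Far (suc k)) x
IsWord⇒far = All.map (λ (_ , q) → inj₂ (s≤s q))

canonical-[] : ∀ n → Canonical (suc n) []
canonical-[] zero    = base
canonical-[] (suc n) = cons {a = suc (suc n)} {j = 0} (s≤s z≤n) (+-identityʳ _) (canonical-[] n)

run-Δ-simple : ∀ m a j → 1 ≤ a → a + j ≡ suc m → ∃ λ q → run j a ++ Δ m ++ q ~ Δ (suc m)
run-Δ-simple zero          (suc zero)          zero    _ refl = [] , ε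
run-Δ-simple (suc k)       (suc zero)          .(suc k) _ refl =
  [] , ≡⇒~ (trans (cong (run (suc k) 1 ++_) (++-identityʳ _)) (sym (Δ-unfold k)))
run-Δ-simple (suc zero)    (suc (suc zero))    zero    _ refl = Δ 2 , ε
run-Δ-simple (suc (suc k)) (suc (suc a)) j _ e
  with run-Δ-simple (suc k) (suc a) j (s≤s z≤n) (suc-injective e)
... | q , ih = N ∷ q , (begin
  R ++ Δ N ++ N ∷ q
    ≡⟨ cong (λ t → R ++ t ++ N ∷ q) (Δ-unfold k) ⟩
  R ++ (run (suc k) 1 ++ D) ++ N ∷ q
    ≡⟨ cong (R ++_) (++-assoc (run (suc k) 1) D _) ⟩
  R ++ run (suc k) 1 ++ D ++ N ∷ q
    ⟶*⟨ ++-congˡ R (++-congˡ (run (suc k) 1) (commute-past N D q (IsWord⇒far (Δ-IsWord (suc k))))) ⟩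
  R ++ run (suc k) 1 ++ N ∷ D ++ q
    ≡⟨ trans (cong (R ++_) (sym (++-assoc (run (suc k) 1) (N ∷ []) _)))
             (trans (cong (λ t → R ++ t ++ D ++ q) (sym run-N)) (sym (++-assoc R _ _))) ⟩
  (R ++ run (a + suc j) 1) ++ D ++ q
    ⟶*⟨ ++-congʳ (D ++ q) (run-exchange 1 a j) ⟩
  (run (a + suc j) 1 ++ run j (suc a)) ++ D ++ q
    ≡⟨ ++-assoc (run (a + suc j) 1) _ _ ⟩
  run (a + suc j) 1 ++ run j (suc a) ++ D ++ q
    ⟶*⟨ ++-congˡ (run (a + suc j) 1) ih ⟩
  run (a + suc j) 1 ++ Δ N
    ≡⟨ trans (cong (λ t → run t 1 ++ Δ N) a+1+j≡N) (sym (Δ-unfold (suc k))) ⟩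
  Δ (suc N) ∎)
  where
  open StarReasoning Step
  N = suc (suc k)
  D = Δ (suc k)
  R = run j (suc (suc a))
  a+1+j≡N : a + suc j ≡ N
  a+1+j≡N = trans (+-suc a j) (suc-injective e)
  run-N : run (a + suc j) 1 ≡ run (suc k) 1 ++ N ∷ []
  run-N = trans (cong (λ t → run t 1) (trans a+1+j≡N (+-comm 1 (suc k)))) (run-++ (suc k) 1 1)

run-++-simple : ∀ {n a j} x r → 1 ≤ a → a + j ≡ suc (suc n) → x ++ r ~ Δ (suc n) →
  ∃ λ q → (run j a ++ x) ++ r ++ q ~ Δ (suc (suc n))
run-++-simple {n} {a} {j} x r p e h with run-Δ-simple (suc n) a j p e
... | q , g = q , (begin
  (run j a ++ x) ++ r ++ q  ≡⟨ trans (++-assoc (run j a) x _) (cong (run j a ++_) (sym (++-assoc x r q))) ⟩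
  run j a ++ (x ++ r) ++ q  ⟶*⟨ ++-congˡ (run j a) (++-congʳ q h) ⟩
  run j a ++ Δ (suc n) ++ q ⟶*⟨ g ⟩
  Δ (suc (suc n))           ∎)
  where open StarReasoning Step

canonical-simple : ∀ {n x} → Canonical n x → x ≼ Δ n
canonical-simple base = [] , ε
canonical-simple (cons {x = x} p e cx) with canonical-simple cx
... | p' , h with run-++-simple x p' p e h
... | q , g = p' ++ q , g

EndsWith : ℕ → Word → Set
EndsWith i x = ∃ λ w → w ++ i ∷ [] ~ x

SimpleWith : ℕ → Word → ℕ → Set
SimpleWith n x i = ∃ λ p → x ++ i ∷ p ~ Δ n

ends-with-top : ∀ {k a j b j' x} → a ≤ b → a + j ≡ suc (suc (suc k)) → b + j' ≡ suc (suc k) →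
  Canonical (suc k) x → EndsWith (suc (suc k)) (run j a ++ run j' b ++ x)
ends-with-top {k} {a} {j} {_} {j'} {x} a≤b e₁ e₂ cx with m≤n⇒∃[o]m+o≡n a≤b
... | d , refl = w , ~-sym (begin
  run j a ++ run j' (a + d) ++ x
    ≡⟨ trans (cong (λ t → run t a ++ run j' (a + d) ++ x) j≡d+1+j') (sym (++-assoc (run (d + suc j') a) _ _)) ⟩
  (run (d + suc j') a ++ run j' (a + d)) ++ x
    ⟶*⟨ ++-congʳ x (~-sym (run-exchange a d j')) ⟩
  (run j' (suc (a + d)) ++ run (d + suc j') a) ++ x
    ≡⟨ trans (++-assoc (run j' (suc (a + d))) _ _)
         (cong (run j' (suc (a + d)) ++_) (trans (cong (_++ x) run-K) (++-assoc (run (d + j') a) _ _))) ⟩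
  run j' (suc (a + d)) ++ run (d + j') a ++ K ∷ x
    ⟶*⟨ ++-congˡ (run j' (suc (a + d))) (++-congˡ (run (d + j') a)
          (≡⇒~ (cong (K ∷_) (sym (++-identityʳ x))) ◅◅
           ~-sym (commute-past K x [] (IsWord⇒far (Canonical-IsWord cx))))) ⟩
  run j' (suc (a + d)) ++ run (d + j') a ++ x ++ K ∷ []
    ≡⟨ trans (cong (run j' (suc (a + d)) ++_) (sym (++-assoc (run (d + j') a) _ _)))
             (sym (++-assoc (run j' (suc (a + d))) _ _)) ⟩
  w ++ K ∷ [] ∎)
  where
  open StarReasoning Step
  K = suc (suc k)
  a+d+j'≡K : a + (d + j') ≡ K
  a+d+j'≡K = trans (sym (+-assoc a d j')) e₂
  j≡d+1+j' : j ≡ d + suc j'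
  j≡d+1+j' = +-cancelˡ-≡ a j (d + suc j')
    (trans e₁ (sym (trans (cong (a +_) (+-suc d j')) (trans (+-suc a _) (cong suc a+d+j'≡K)))))
  run-K : run (d + suc j') a ≡ run (d + j') a ++ K ∷ []
  run-K = trans (cong (λ t → run t a) (trans (+-suc d j') (+-comm 1 (d + j'))))
            (trans (run-++ (d + j') 1 a) (cong (λ t → run (d + j') a ++ t ∷ []) a+d+j'≡K))
  w = run j' (suc (a + d)) ++ run (d + j') a ++ x

simple-with-top : ∀ {k b d j j' x} → 1 ≤ b → suc (b + d) + j ≡ suc (suc (suc k)) → b + j' ≡ suc (suc k) →
  Canonical (suc k) x → SimpleWith (suc (suc (suc k))) (run j (suc (b + d)) ++ run j' b ++ x) (suc (suc k))
simple-with-top {k} {b} {d} {j} {j'} {x} 1≤b e₁ e₂ cx = p , (begin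
  (A ++ run j' b ++ x) ++ K ∷ p
    ≡⟨ trans (++-assoc A _ _) (cong (A ++_) (++-assoc (run j' b) _ _)) ⟩
  A ++ run j' b ++ x ++ K ∷ p
    ⟶*⟨ ++-congˡ A (++-congˡ (run j' b) (commute-past K x p (IsWord⇒far (Canonical-IsWord cx)))) ⟩
  A ++ run j' b ++ K ∷ x ++ p
    ≡⟨ trans (cong (A ++_) (trans (sym (++-assoc (run j' b) (K ∷ []) _)) (cong (_++ x ++ p) (sym run-K))))
             (sym (++-assoc A _ _)) ⟩
  (A ++ run (d + suc j) b) ++ x ++ p
    ⟶*⟨ ++-congʳ (x ++ p) (run-exchange b d j) ⟩
  (run (d + suc j) b ++ run j (b + d)) ++ x ++ p
    ≡⟨ trans (++-assoc (run (d + suc j) b) _ _)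
         (trans (cong (run (d + suc j) b ++_) (sym (++-assoc (run j (b + d)) x p)))
                (sym (++-assoc (run (d + suc j) b) _ p))) ⟩
  (run (d + suc j) b ++ run j (b + d) ++ x) ++ p
    ⟶*⟨ proj₂ (canonical-simple exchanged) ⟩
  Δ (suc (suc (suc k))) ∎)
  where
  open StarReasoning Step
  K = suc (suc k)
  A = run j (suc (b + d))
  b+d+j≡K : b + d + j ≡ K
  b+d+j≡K = suc-injective e₁
  exchanged : Canonical (suc (suc (suc k))) (run (d + suc j) b ++ run j (b + d) ++ x)
  exchanged = cons 1≤b (trans (cong (b +_) (+-suc d j))
                              (trans (+-suc b _) (cong suc (trans (sym (+-assoc b d j)) b+d+j≡K))))
                (cons (≤-trans 1≤b (m≤m+n b d)) b+d+j≡K cx)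
  j'≡d+j : j' ≡ d + j
  j'≡d+j = +-cancelˡ-≡ b j' (d + j) (trans e₂ (sym (trans (sym (+-assoc b d j)) b+d+j≡K)))
  run-K : run (d + suc j) b ≡ run j' b ++ K ∷ []
  run-K = trans (cong (λ t → run t b) (trans (+-suc d j) (trans (cong suc (sym j'≡d+j)) (+-comm 1 j'))))
            (trans (run-++ j' 1 b) (cong (λ t → run j' b ++ t ∷ []) e₂))
  p = proj₁ (canonical-simple exchanged)

top-ends-with-or-simple-with : ∀ {n a j x} → 1 ≤ a → a + j ≡ suc (suc n) → Canonical (suc n) x →
  EndsWith (suc n) (run j a ++ x) ⊎ SimpleWith (suc (suc n)) (run j a ++ x) (suc n)
top-ends-with-or-simple-with {zero}  {suc zero}       _ refl base = inj₁ ([] , ε)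
top-ends-with-or-simple-with {zero}  {suc (suc zero)} _ refl base = inj₂ ([] , ε)
top-ends-with-or-simple-with {suc k} {a} 1≤a e (cons {a = b} 1≤b e' cx) with a ≤? b
... | yes a≤b = inj₁ (ends-with-top a≤b e e' cx)
... | no  a≰b with m≤n⇒∃[o]m+o≡n (≰⇒> a≰b)
...   | d , refl = inj₂ (simple-with-top 1≤b e e' cx)

ends-with-or-simple-with : ∀ {n x} → Canonical n x → ∀ {i} → Gen n i → EndsWith i x ⊎ SimpleWith n x i
ends-with-or-simple-with base {zero}  (() , _)
ends-with-or-simple-with base {suc i} (_ , s≤s ())
ends-with-or-simple-with (cons {n} {a} {j} {x} 1≤a e cx) {i} (1≤i , i<n) with suc i ≤? suc n
... | yes i<n' with ends-with-or-simple-with cx (1≤i , i<n')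
...   | inj₁ (w , h) = inj₁ (run j a ++ w , ≡⇒~ (++-assoc (run j a) w _) ◅◅ ++-congˡ (run j a) h)
...   | inj₂ (p , h) with run-++-simple x (i ∷ p) 1≤a e h
...     | q , g = inj₂ (p ++ q , g)
ends-with-or-simple-with (cons 1≤a e cx) (1≤i , i<n) | no i≮n'
  with ≤-antisym (≤-pred i<n) (≤-pred (≰⇒> i≮n'))
... | refl = top-ends-with-or-simple-with 1≤a e cx

generator-≼-Δ : ∀ n {i} → Gen (suc n) i → i ∷ [] ≼ Δ (suc n)
generator-≼-Δ n g with ends-with-or-simple-with (canonical-[] n) g
... | inj₁ (w , h) = ⊥-elim (0≢1+n (trans (sym (~-length h)) (trans (length-++ w) (+-comm (length w) 1))))
... | inj₂ s       = s

-- The canonical words other than Δ_n.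
data Proper : ℕ → Word → Set where
  short : ∀ {n a j x} → 2 ≤ a → a + j ≡ suc (suc n) → Canonical (suc n) x → Proper (suc (suc n)) (run j a ++ x)
  full  : ∀ {n x} → Proper (suc n) x → Canonical (suc n) x → Proper (suc (suc n)) (run (suc n) 1 ++ x)

proper⇒canonical : ∀ {n x} → Proper n x → Canonical n x
proper⇒canonical (short 2≤a e cx) = cons (≤-trans (s≤s z≤n) 2≤a) e cx
proper⇒canonical (full _ cx)      = cons (s≤s z≤n) refl cx

short-simple-with : ∀ k {a j x} → 2 ≤ a → a + j ≡ suc (suc k) → Canonical (suc k) x →
  ∃ λ i → Gen (suc (suc k)) i × SimpleWith (suc (suc k)) (run j a ++ x) i
short-simple-with zero {suc (suc zero)} _ refl base = 1 , (s≤s z≤n , ≤-refl) , [] , ε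
short-simple-with zero {suc zero} (s≤s ()) _ _
short-simple-with (suc k) {a} 2≤a e (cons {a = b} {j = j'} {x = x} 1≤b e' cx) with a ≤? b
... | no a≰b with m≤n⇒∃[o]m+o≡n (≰⇒> a≰b)
...   | d , refl = suc (suc k) , (s≤s z≤n , ≤-refl) , simple-with-top 1≤b e e' cx
short-simple-with (suc k) {a} 2≤a e (cons {a = b} {j = j'} {x = x} 1≤b e' cx) | yes a≤b
  with short-simple-with k (≤-trans 2≤a a≤b) e' cx
... | i , g , p , h with run-++-simple (run j' b ++ x) (i ∷ p) (≤-trans (s≤s z≤n) 2≤a) e h
...   | q , h' = i , Gen-suc g , p ++ q , h'

proper-simple-with : ∀ {n x} → Proper n x → ∃ λ i → Gen n i × SimpleWith n x i
proper-simple-with (short {k} 2≤a e cx) = short-simple-with k 2≤a e cx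
proper-simple-with (full {n} {x} px _) with proper-simple-with px
... | i , g , p , h with run-++-simple {n} {1} {suc n} x (i ∷ p) (s≤s z≤n) refl h
...   | q , h' = i , Gen-suc g , p ++ q , h'

-- Normality through descent sets

LeftDiv⇒≼ : ∀ {n x y} → LeftDiv n x y → x ≼ y
LeftDiv⇒≼ (z , _ , e) = z , ≈⇒~ e

≼⇒LeftDiv : ∀ {n x y} → IsWord n y → x ≼ y → LeftDiv n x y
≼⇒LeftDiv {x = x} wy (z , e) = z , ++⁻ʳ x (~-All (~-sym e) wy) , ~⇒≈ e

EndsWith⇒RightDiv : ∀ {n x i} → IsWord n x → EndsWith i x → RightDiv n (i ∷ []) x
EndsWith⇒RightDiv wx (z , e) = z , ++⁻ˡ z (~-All (~-sym e) wx) , ~⇒≈ e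

++-∷-≁ : ∀ x (u : Word) i → ¬ (x ++ i ∷ u ~ x)
++-∷-≁ x u i e = m+1+n≢m (length x) (trans (sym (length-++ x)) (~-length e))

¬RightDiv-[] : ∀ {n i} → ¬ RightDiv n (i ∷ []) []
¬RightDiv-[] (z , _ , e) = m+1+n≢0 (length z) (trans (sym (length-++ z)) (~-length (≈⇒~ e)))

¬LeftDiv-[] : ∀ {n i} → ¬ LeftDiv n (i ∷ []) []
¬LeftDiv-[] (z , _ , e) = 0≢1+n (sym (~-length (≈⇒~ e)))

right-descent-¬SimpleWith : ∀ {n x i} → RightDiv n (i ∷ []) x → ¬ SimpleWith n x i
right-descent-¬SimpleWith {n} {x} {i} (u , _ , u·i≈x) (p , h) =
  Δ-squarefree n u i p (≡⇒~ (sym (++-assoc u (i ∷ []) _)) ◅◅ ++-congʳ (i ∷ p) (≈⇒~ u·i≈x) ◅◅ h)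

DL⊆DR : ℕ → Word → Word → Set
DL⊆DR n x y = ∀ i → DL n y i → DR n x i

-- If σ_i ∈ D_L(y) ∖ D_R(x), then x σ_i is simple and divides xy, so it
-- divides the gcd x of Δ_n and xy.
normal⇒DL⊆DR : ∀ {n x y} → Canonical n x → IsWord n y → Normal n x y → DL⊆DR n x y
normal⇒DL⊆DR {n} {x} {y} cx wy (_ , _ , gcd) i (gi , w , _ , i·w≈y)
  with ends-with-or-simple-with cx gi
... | inj₁ ends = gi , EndsWith⇒RightDiv (Canonical-IsWord cx) ends
... | inj₂ (p , h)
  with gcd (x ++ i ∷ []) (++⁺ (Canonical-IsWord cx) (gi ∷ []))
           (≼⇒LeftDiv (Δ-IsWord n) (p , ≡⇒~ (++-assoc x (i ∷ []) p) ◅◅ h))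
           (≼⇒LeftDiv (++⁺ (Canonical-IsWord cx) wy) (w , ≡⇒~ (++-assoc x (i ∷ []) w) ◅◅ ++-congˡ x (≈⇒~ i·w≈y)))
...   | u , _ , e = ⊥-elim (++-∷-≁ x u i (≡⇒~ (sym (++-assoc x (i ∷ []) u)) ◅◅ ≈⇒~ e))

-- Writing Δ_n = x p, the words p and y have no common first letter (it would
-- give a square σ_i σ_i in Δ_n), so every common divisor of x p and x y divides x.
DL⊆DR⇒normal : ∀ {n x y} → Canonical n x → IsWord n y → DL⊆DR n x y → Normal n x y
DL⊆DR⇒normal {n} {x} {y} cx wy descents =
  ≼⇒LeftDiv (Δ-IsWord n) (p , x·p~Δ) , (y , wy , ≈-refl) , greatest
  where
  p = proj₁ (canonical-simple cx)
  x·p~Δ = proj₂ (canonical-simple cx)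
  coprime : NoCommonHead p y
  coprime i {w} {w'} i·w~p i·w'~y with ~-All (~-sym i·w'~y) wy
  ... | gi ∷ gw' = right-descent-¬SimpleWith (proj₂ (descents i (gi , w' , gw' , ~⇒≈ i·w'~y)))
                                             (w , ++-congˡ x i·w~p ◅◅ x·p~Δ)
  greatest : ∀ z → IsWord n z → LeftDiv n z (Δ n) → LeftDiv n z (x ++ y) → LeftDiv n z x
  greatest z _ z≼Δ z≼xy with LeftDiv⇒≼ z≼Δ
  ... | u , f = ≼⇒LeftDiv (Canonical-IsWord cx) (≼-prefix z x coprime (u , f ◅◅ ~-sym x·p~Δ) (LeftDiv⇒≼ z≼xy))

normal⇔DL⊆DR : ∀ {n x y} → Canonical n x → IsWord n y → Normal n x y ⇔ DL⊆DR n x y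
normal⇔DL⊆DR cx wy = mk⇔ (normal⇒DL⊆DR cx wy) (DL⊆DR⇒normal cx wy)

-- The lists S_n

nth-All : ∀ {P : Word → Set} l k → All P l → 1 ≤ k → k ≤ length l → P (nth l k)
nth-All (x ∷ l) (suc zero)    (px ∷ _)  _ _        = px
nth-All (x ∷ l) (suc (suc k)) (_ ∷ pl) _ (s≤s le) = nth-All l (suc k) pl (s≤s z≤n) le

nth-++ˡ : ∀ l₁ l₂ k → 1 ≤ k → k ≤ length l₁ → nth (l₁ ++ l₂) k ≡ nth l₁ k
nth-++ˡ (x ∷ l₁) l₂ (suc zero)    _ _        = refl
nth-++ˡ (x ∷ l₁) l₂ (suc (suc k)) _ (s≤s le) = nth-++ˡ l₁ l₂ (suc k) (s≤s z≤n) le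

nth-++ʳ : ∀ l₁ l₂ k → 1 ≤ k → nth (l₁ ++ l₂) (length l₁ + k) ≡ nth l₂ k
nth-++ʳ []       l₂ k       _ = refl
nth-++ʳ (x ∷ l₁) l₂ (suc k) _ rewrite +-suc (length l₁) k =
  trans (cong (nth (l₁ ++ l₂)) (sym (+-suc (length l₁) k))) (nth-++ʳ l₁ l₂ (suc k) (s≤s z≤n))

nth-map : ∀ (g : Word → Word) l k → 1 ≤ k → k ≤ length l → nth (map g l) k ≡ g (nth l k)
nth-map g (x ∷ l) (suc zero)    _ _        = refl
nth-map g (x ∷ l) (suc (suc k)) _ (s≤s le) = nth-map g l (suc k) (s≤s z≤n) le

block : ℕ → ℕ → List Word
block m i = map (σ[ i , suc (suc m) ] ++_) (S (suc m))

length-concatMap-downFrom : ∀ (g : ℕ → List Word) r L → (∀ i → length (g i) ≡ L) →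
  length (concatMap g (downFrom r)) ≡ r * L
length-concatMap-downFrom g zero    L h = refl
length-concatMap-downFrom g (suc r) L h =
  trans (length-++ (g (suc r))) (cong₂ _+_ (h (suc r)) (length-concatMap-downFrom g r L h))

length-S : ∀ m → length (S (suc m)) ≡ suc m !
length-S zero    = refl
length-S (suc m) = length-concatMap-downFrom (block m) (suc (suc m)) (suc m !) length-block
  where
  length-block : ∀ i → length (block m i) ≡ suc m !
  length-block i = trans (length-map _ (S (suc m))) (length-S m)

nth-concatMap-downFrom : ∀ (g : ℕ → List Word) L r j k → (∀ i → length (g i) ≡ L) → j < r →
  1 ≤ k → k ≤ L → nth (concatMap g (downFrom r)) (k + j * L) ≡ nth (g (r ∸ j)) k
nth-concatMap-downFrom g L (suc r) zero k hl _ pk qk =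
  trans (cong (nth (concatMap g (downFrom (suc r)))) (+-identityʳ k))
        (nth-++ˡ (g (suc r)) _ k pk (subst (k ≤_) (sym (hl (suc r))) qk))
nth-concatMap-downFrom g L (suc r) (suc j) k hl (s≤s j<r) pk qk = begin
  nth (g (suc r) ++ rest) (k + (L + j * L))
    ≡⟨ cong (nth (g (suc r) ++ rest)) shift ⟩
  nth (g (suc r) ++ rest) (length (g (suc r)) + (k + j * L))
    ≡⟨ nth-++ʳ (g (suc r)) _ (k + j * L) (≤-trans pk (m≤m+n k _)) ⟩
  nth rest (k + j * L)
    ≡⟨ nth-concatMap-downFrom g L r j k hl j<r pk qk ⟩
  nth (g (r ∸ j)) k ∎
  where
  open ≡-Reasoning
  rest = concatMap g (downFrom r)
  shift : k + (L + j * L) ≡ length (g (suc r)) + (k + j * L)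
  shift = trans (x∙yz≈y∙xz k L (j * L)) (cong (_+ (k + j * L)) (sym (hl (suc r))))

downFrom-range : ∀ r → All (λ i → 1 ≤ i × i ≤ r) (downFrom r)
downFrom-range zero    = []
downFrom-range (suc r) = (s≤s z≤n , ≤-refl) ∷ All.map (λ (p , q) → p , m≤n⇒m≤1+n q) (downFrom-range r)

All-concatMap : ∀ {P : Word → Set} (g : ℕ → List Word) is → All (λ i → All P (g i)) is → All P (concatMap g is)
All-concatMap g is h = concat⁺ (map⁺ h)

σ-++-canonical : ∀ {m i x} → 1 ≤ i → i ≤ suc (suc m) → Canonical (suc m) x →
  Canonical (suc (suc m)) (σ[ i , suc (suc m) ] ++ x)
σ-++-canonical {m} {i} {x} p q cx =
  subst (λ s → Canonical (suc (suc m)) (s ++ x)) (sym (σ-run i (suc (suc m)))) (cons p (m+[n∸m]≡n q) cx)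

S-canonical : ∀ m → All (Canonical (suc m)) (S (suc m))
S-canonical zero    = base ∷ []
S-canonical (suc m) = All-concatMap (block m) (downFrom (suc (suc m)))
  (All.map (λ (p , q) → map⁺ (All.map (σ-++-canonical p q) (S-canonical m))) (downFrom-range (suc (suc m))))

downFrom-suc : ∀ r → downFrom (suc r) ≡ map suc (downFrom r) ++ 1 ∷ []
downFrom-suc zero    = refl
downFrom-suc (suc r) = cong (suc (suc r) ∷_) (downFrom-suc r)

σ-diagonal : ∀ N → σ[ N , N ] ≡ []
σ-diagonal N = trans (σ-run N N) (cong (λ s → run s N) (n∸n≡0 N))

S-last : ∀ m → ∃ λ F → S (suc m) ≡ F ++ Δ (suc m) ∷ [] × All (Proper (suc m)) F
S-last zero = [] , refl , []
S-last (suc m) with S-last m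
... | F , eq , proper-F = A ++ map (σ[ 1 , N ] ++_) F , S-N , ++⁺ proper-A proper-B
  where
  N = suc (suc m)
  A = concatMap (block m) (map suc (downFrom (suc m)))
  S-N : S N ≡ (A ++ map (σ[ 1 , N ] ++_) F) ++ Δ N ∷ []
  S-N = begin
    concatMap (block m) (downFrom N)
      ≡⟨ cong (concatMap (block m)) (downFrom-suc (suc m)) ⟩
    concatMap (block m) (map suc (downFrom (suc m)) ++ 1 ∷ [])
      ≡⟨ concatMap-++ (block m) (map suc (downFrom (suc m))) (1 ∷ []) ⟩
    A ++ (block m 1 ++ [])
      ≡⟨ cong (A ++_) (++-identityʳ _) ⟩
    A ++ map (σ[ 1 , N ] ++_) (S (suc m))
      ≡⟨ cong (λ l → A ++ map (σ[ 1 , N ] ++_) l) eq ⟩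
    A ++ map (σ[ 1 , N ] ++_) (F ++ Δ (suc m) ∷ [])
      ≡⟨ cong (A ++_) (map-++ (σ[ 1 , N ] ++_) F _) ⟩
    A ++ (map (σ[ 1 , N ] ++_) F ++ Δ N ∷ [])
      ≡⟨ ++-assoc A _ _ ⟨
    (A ++ map (σ[ 1 , N ] ++_) F) ++ Δ N ∷ [] ∎
    where open ≡-Reasoning
  proper-A : All (Proper N) A
  proper-A = All-concatMap (block m) (map suc (downFrom (suc m)))
    (map⁺ (All.map (λ (p , q) → map⁺ (All.map (λ {x} cx →
       subst (λ s → Proper N (s ++ x)) (sym (σ-run (suc _) N)) (short (s≤s p) (m+[n∸m]≡n (s≤s q)) cx))
       (S-canonical m))) (downFrom-range (suc m))))
  proper-B : All (Proper N) (map (σ[ 1 , N ] ++_) F)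
  proper-B = map⁺ (All.map (λ {x} px → subst (λ s → Proper N (s ++ x)) (sym (σ-run 1 N))
                                              (full px (proper⇒canonical px))) proper-F)

NonEmpty : Word → Set
NonEmpty w = ∃ λ a → ∃ λ w' → w ≡ a ∷ w'

σ-++-nonEmpty : ∀ i N x → i < N → NonEmpty (σ[ i , N ] ++ x)
σ-++-nonEmpty i N x i<N with m≤n⇒∃[o]m+o≡n i<N
... | t , e = i , run t (suc i) ++ x , cong (_++ x) (trans (σ-run i N) (cong (λ s → run s i) N∸i≡1+t))
  where
  N∸i≡1+t : N ∸ i ≡ suc t
  N∸i≡1+t = trans (cong (_∸ i) (trans (sym e) (sym (+-suc i t)))) (m+n∸m≡n i (suc t))

S-first : ∀ m → ∃ λ G → S (suc m) ≡ [] ∷ G × All NonEmpty G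
S-first zero = [] , refl , []
S-first (suc m) with S-first m
... | G , eq , nonEmpty-G = G ++ rest , S-N , ++⁺ nonEmpty-G nonEmpty-rest
  where
  N = suc (suc m)
  rest = concatMap (block m) (downFrom (suc m))
  S-N : S N ≡ [] ∷ (G ++ rest)
  S-N = cong (_++ rest)
          (trans (cong (λ s → map (s ++_) (S (suc m))) (σ-diagonal N)) (trans (map-id (S (suc m))) eq))
  nonEmpty-rest : All NonEmpty rest
  nonEmpty-rest = All-concatMap (block m) (downFrom (suc m))
    (All.map (λ (_ , q) → map⁺ (All.map (λ {x} _ → σ-++-nonEmpty _ N x (s≤s q)) (S-canonical m)))
             (downFrom-range (suc m)))

τ-canonical : ∀ m k → Idx (suc m) k → Canonical (suc m) (τ (suc m) k)
τ-canonical m k (1≤k , k≤n!) =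
  nth-All (S (suc m)) k (S-canonical m) 1≤k (subst (k ≤_) (sym (length-S m)) k≤n!)

τ-IsWord : ∀ m k → Idx (suc m) k → IsWord (suc m) (τ (suc m) k)
τ-IsWord m k ik = Canonical-IsWord (τ-canonical m k ik)

τ-first : ∀ m → τ (suc m) 1 ≡ []
τ-first m = cong (λ l → nth l 1) (proj₁ (proj₂ (S-first m)))

τ-nonEmpty : ∀ m ℓ → 2 ≤ ℓ → ℓ ≤ suc m ! → NonEmpty (τ (suc m) ℓ)
τ-nonEmpty m (suc zero)    (s≤s ()) _
τ-nonEmpty m (suc (suc ℓ)) _ ℓ≤n! with S-first m
... | G , eq , nonEmpty-G = subst NonEmpty (sym (cong (λ l → nth l (suc (suc ℓ))) eq))
    (nth-All G (suc ℓ) nonEmpty-G (s≤s z≤n) (≤-pred (subst (suc (suc ℓ) ≤_) n!≡1+∣G∣ ℓ≤n!)))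
  where
  n!≡1+∣G∣ : suc m ! ≡ suc (length G)
  n!≡1+∣G∣ = trans (sym (length-S m)) (cong length eq)

length-S-last : ∀ m {F} → S (suc m) ≡ F ++ Δ (suc m) ∷ [] → suc m ! ≡ length F + 1
length-S-last m {F} eq = trans (sym (length-S m)) (trans (cong length eq) (length-++ F))

τ-last : ∀ m → τ (suc m) (suc m !) ≡ Δ (suc m)
τ-last m with S-last m
... | F , eq , _ = trans (cong₂ nth eq (length-S-last m eq)) (nth-++ʳ F (Δ (suc m) ∷ []) 1 ≤-refl)

τ-proper : ∀ m k → 1 ≤ k → k < suc m ! → Proper (suc m) (τ (suc m) k)
τ-proper m k 1≤k k<n! with S-last m
... | F , eq , proper-F =
  subst (Proper (suc m)) (sym (trans (cong (λ l → nth l k) eq) (nth-++ˡ F _ k 1≤k k≤∣F∣)))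
        (nth-All F k proper-F 1≤k k≤∣F∣)
  where
  k≤∣F∣ : k ≤ length F
  k≤∣F∣ = ≤-pred (subst (suc k ≤_) (trans (length-S-last m eq) (+-comm (length F) 1)) k<n!)

τ-block : ∀ m k j → Idx (suc m) k → j < suc (suc m) →
  τ (suc (suc m)) (k + j * suc m !) ≡ σ[ suc (suc m) ∸ j , suc (suc m) ] ++ τ (suc m) k
τ-block m k j (1≤k , k≤n!) j<N =
  trans (nth-concatMap-downFrom (block m) (suc m !) (suc (suc m)) j k length-block j<N 1≤k k≤n!)
        (nth-map _ (S (suc m)) k 1≤k (subst (k ≤_) (sym (length-S m)) k≤n!))
  where
  length-block : ∀ i → length (block m i) ≡ suc m !
  length-block i = trans (length-map _ (S (suc m))) (length-S m)

τ-initial : ∀ m ℓ → Idx (suc m) ℓ → τ (suc (suc m)) ℓ ≡ τ (suc m) ℓ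
τ-initial m ℓ iℓ = begin
  τ (suc (suc m)) ℓ                                 ≡⟨ cong (τ (suc (suc m))) (+-identityʳ ℓ) ⟨
  τ (suc (suc m)) (ℓ + 0)                           ≡⟨ τ-block m ℓ 0 iℓ (s≤s z≤n) ⟩
  σ[ suc (suc m) , suc (suc m) ] ++ τ (suc m) ℓ     ≡⟨ cong (_++ τ (suc m) ℓ) (σ-diagonal (suc (suc m))) ⟩
  τ (suc m) ℓ                                       ∎
  where open ≡-Reasoning

-- The matrices M_n

Δ-normal : ∀ {n y} → IsWord n y → Normal n (Δ n) y
Δ-normal {n} {y} wy = ([] , [] , ~⇒≈ (≡⇒~ (++-identityʳ (Δ n)))) , (y , wy , ≈-refl) , λ _ _ z≼Δ _ → z≼Δ

DL-suc : ∀ {n y i} → DL n y i → DL (suc n) y i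
DL-suc (gi , w , iw , e) = Gen-suc gi , w , All.map Gen-suc iw , e

DL-head : ∀ {n a w} → IsWord n (a ∷ w) → DL n (a ∷ w) a
DL-head (ga ∷ iw) = ga , _ , iw , ≈-refl

DL-pred : ∀ {n y i} → IsWord n y → DL (suc n) y i → DL n y i
DL-pred wy (_ , w , _ , e) with ~-All (~-sym (≈⇒~ e)) wy
... | gi ∷ iw = gi , w , iw , e

-- A left descent of y ∈ B_{m+1}^+ lies in B_{m+1}^+, where the factor
-- σ_{a,m+2} cannot create a right descent of x: if σ_i ∉ D_R(x) then x σ_i is
-- simple, and so is σ_{a,m+2} x σ_i.
DL⊆DR-run-++ : ∀ {m a j x y} → 1 ≤ a → a + j ≡ suc (suc m) → Canonical (suc m) x → IsWord (suc m) y →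
  DL⊆DR (suc (suc m)) (run j a ++ x) y ⇔ DL⊆DR (suc m) x y
DL⊆DR-run-++ {m} {a} {j} {x} {y} 1≤a e cx wy = mk⇔ restrict extend
  where
  cx' = cons 1≤a e cx
  restrict : DL⊆DR (suc (suc m)) (run j a ++ x) y → DL⊆DR (suc m) x y
  restrict descents i dl@(gi , _) with ends-with-or-simple-with cx gi
  ... | inj₁ ends       = gi , EndsWith⇒RightDiv (Canonical-IsWord cx) ends
  ... | inj₂ (p , x·i·p~Δ) with run-++-simple x (i ∷ p) 1≤a e x·i·p~Δ
  ...   | q , h = ⊥-elim (right-descent-¬SimpleWith (proj₂ (descents i (DL-suc dl))) (p ++ q , h))
  extend : DL⊆DR (suc m) x y → DL⊆DR (suc (suc m)) (run j a ++ x) y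
  extend descents i dl@(gi , _) with descents i (DL-pred wy dl)
  ... | _ , u , _ , u·i≈x = gi , EndsWith⇒RightDiv (Canonical-IsWord cx')
          (run j a ++ u , ≡⇒~ (++-assoc (run j a) u _) ◅◅ ++-congˡ (run j a) (≈⇒~ u·i≈x))

DL⊆DR-σ-++ : ∀ {m i x y} → 1 ≤ i → i ≤ suc (suc m) → Canonical (suc m) x → IsWord (suc m) y →
  DL⊆DR (suc (suc m)) (σ[ i , suc (suc m) ] ++ x) y ⇔ DL⊆DR (suc m) x y
DL⊆DR-σ-++ {m} {i} {x} {y} 1≤i i≤N cx wy =
  subst (λ s → DL⊆DR (suc (suc m)) (s ++ x) y ⇔ DL⊆DR (suc m) x y) (sym (σ-run i (suc (suc m))))
        (DL⊆DR-run-++ 1≤i (m+[n∸m]≡n i≤N) cx wy)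

normal-respects-DR : ∀ {n x x' y} → Canonical n x → Canonical n x' → IsWord n y →
  (∀ i → DR n x i ⇔ DR n x' i) → Normal n x y ⇔ Normal n x' y
normal-respects-DR cx cx' wy same =
  mk⇔ (λ nxy → DL⊆DR⇒normal cx' wy λ i dl → Equivalence.to   (same i) (normal⇒DL⊆DR cx  wy nxy i dl))
      (λ nxy → DL⊆DR⇒normal cx  wy λ i dl → Equivalence.from (same i) (normal⇒DL⊆DR cx' wy nxy i dl))

normal-respects-DL : ∀ {n x y y'} → Canonical n x → IsWord n y → IsWord n y' →
  (∀ i → DL n y i ⇔ DL n y' i) → Normal n x y ⇔ Normal n x y'
normal-respects-DL cx wy wy' same =
  mk⇔ (λ nxy → DL⊆DR⇒normal cx wy' λ i dl → normal⇒DL⊆DR cx wy  nxy i (Equivalence.from (same i) dl))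
      (λ nxy → DL⊆DR⇒normal cx wy  λ i dl → normal⇒DL⊆DR cx wy' nxy i (Equivalence.to   (same i) dl))

M-first-column : ∀ m k → Idx (suc m) k → M (suc m) k 1
M-first-column m k ik = DL⊆DR⇒normal (τ-canonical m k ik) (subst (IsWord (suc m)) (sym (τ-first m)) [])
  λ i (_ , i≼τ₁) → ⊥-elim (¬LeftDiv-[] (subst (LeftDiv (suc m) (i ∷ [])) (τ-first m) i≼τ₁))

M-last-row : ∀ m ℓ → Idx (suc m) ℓ → M (suc m) (suc m !) ℓ
M-last-row m ℓ iℓ = subst (λ x → Normal (suc m) x (τ (suc m) ℓ)) (sym (τ-last m)) (Δ-normal (τ-IsWord m ℓ iℓ))

M-first-row : ∀ m ℓ → 2 ≤ ℓ → ℓ ≤ suc m ! → ¬ M (suc m) 1 ℓ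
M-first-row m ℓ 2≤ℓ ℓ≤n! normal with τ-nonEmpty m ℓ 2≤ℓ ℓ≤n!
... | a , w , τℓ≡a∷w = ¬RightDiv-[] (subst (RightDiv (suc m) (a ∷ [])) (τ-first m) (proj₂ (descents a dl)))
  where
  iℓ : Idx (suc m) ℓ
  iℓ = ≤-trans (s≤s z≤n) 2≤ℓ , ℓ≤n!
  descents = normal⇒DL⊆DR (τ-canonical m 1 (≤-refl , 1≤n! (suc m))) (τ-IsWord m ℓ iℓ) normal
  dl : DL (suc m) (τ (suc m) ℓ) a
  dl = subst (λ y → DL (suc m) y a) (sym τℓ≡a∷w) (DL-head (subst (IsWord (suc m)) τℓ≡a∷w (τ-IsWord m ℓ iℓ)))

-- τ_k σ_i is simple for some i, while σ_i ∈ D_L(Δ_n) = D_L(τ_{n!}).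
M-last-column : ∀ m k → 1 ≤ k → k < suc m ! → ¬ M (suc m) k (suc m !)
M-last-column m k 1≤k k<n! normal with proper-simple-with (τ-proper m k 1≤k k<n!)
... | i , gi , simple = right-descent-¬SimpleWith (proj₂ (descents i dl)) simple
  where
  descents = normal⇒DL⊆DR (τ-canonical m k (1≤k , <⇒≤ k<n!))
                           (τ-IsWord m (suc m !) (1≤n! (suc m) , ≤-refl)) normal
  dl : DL (suc m) (τ (suc m) (suc m !)) i
  dl = subst (λ y → DL (suc m) y i) (sym (τ-last m)) (gi , ≼⇒LeftDiv (Δ-IsWord (suc m)) (generator-≼-Δ m gi))

M-stacked : ∀ m k ℓ j → Idx (suc m) k → Idx (suc m) ℓ → j < suc (suc m) →
  M (suc (suc m)) (k + j * suc m !) ℓ ⇔ M (suc m) k ℓ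
M-stacked m k ℓ j ik iℓ j<N =
  subst₂ (λ x y → Normal N x y ⇔ M (suc m) k ℓ) (sym (τ-block m k j ik j<N)) (sym (τ-initial m ℓ iℓ))
    (⇔.trans (normal⇔DL⊆DR (σ-++-canonical 1≤N∸j (m∸n≤m N j) cx) (All.map Gen-suc wy))
    (⇔.trans (DL⊆DR-σ-++ 1≤N∸j (m∸n≤m N j) cx wy)
             (⇔.sym (normal⇔DL⊆DR cx wy))))
  where
  N = suc (suc m)
  1≤N∸j = m<n⇒0<n∸m j<N
  cx = τ-canonical m k ik
  wy = τ-IsWord m ℓ iℓ

M-rows : ∀ m k k' → Idx (suc m) k → Idx (suc m) k' →
  (∀ i → DR (suc m) (τ (suc m) k) i ⇔ DR (suc m) (τ (suc m) k') i) →
  ∀ ℓ → Idx (suc m) ℓ → M (suc m) k ℓ ⇔ M (suc m) k' ℓ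
M-rows m k k' ik ik' same ℓ iℓ =
  normal-respects-DR (τ-canonical m k ik) (τ-canonical m k' ik') (τ-IsWord m ℓ iℓ) same

M-columns : ∀ m ℓ ℓ' → Idx (suc m) ℓ → Idx (suc m) ℓ' →
  (∀ i → DL (suc m) (τ (suc m) ℓ) i ⇔ DL (suc m) (τ (suc m) ℓ') i) →
  ∀ k → Idx (suc m) k → M (suc m) k ℓ ⇔ M (suc m) k ℓ'
M-columns m ℓ ℓ' iℓ iℓ' same k ik =
  normal-respects-DL (τ-canonical m k ik) (τ-IsWord m ℓ iℓ) (τ-IsWord m ℓ' iℓ') same

lemma2p5 : (n : ℕ) → 2 ≤ n →
    -- (i)
    ((∀ k → Idx n k → M n k 1) ×
     (∀ ℓ → Idx n ℓ → M n (n !) ℓ) ×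
     (∀ ℓ → 2 ≤ ℓ → ℓ ≤ n ! → ¬ M n 1 ℓ) ×
     (∀ k → 1 ≤ k → k < n ! → ¬ M n k (n !))) ×
    -- (ii)
    (∀ k ℓ j → Idx (n ∸ 1) k → Idx (n ∸ 1) ℓ → j < n →
      (M n (k + j * (n ∸ 1) !) ℓ ⇔ M (n ∸ 1) k ℓ)) ×
    -- (iii)
    (∀ k k' → Idx n k → Idx n k' →
      (∀ i → DR n (τ n k) i ⇔ DR n (τ n k') i) →
      ∀ ℓ → Idx n ℓ → (M n k ℓ ⇔ M n k' ℓ)) ×
    (∀ ℓ ℓ' → Idx n ℓ → Idx n ℓ' →
      (∀ i → DL n (τ n ℓ) i ⇔ DL n (τ n ℓ') i) →
      ∀ k → Idx n k → (M n k ℓ ⇔ M n k ℓ'))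
lemma2p5 (suc zero)    (s≤s ())
lemma2p5 (suc (suc m)) _ =
  (M-first-column (suc m) , M-last-row (suc m) , M-first-row (suc m) , M-last-column (suc m)) ,
  M-stacked m , M-rows (suc m) , M-columns (suc m)
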